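{- For any $n>0$, distinct atoms $a_1,\dots,a_n$, $k\ge0$ and $1\le l\le n$, the derivation $\Gamma^n_{k,l}(a_1,\dots,a_n)$ (with its general weakening and coweakening instances realised by atomic ones) is a derivation using only the rules $\mathsf{aw}{\downarrow}$ and $\mathsf{aw}{\uparrow}$ (and $=$) from $\theta^n_k(a_1,\dots,a_n)\{a_l/\mathsf f\}$ to $\theta^n_{k+1}(a_1,\dots,a_n)\{a_l/\mathsf t\}$, and its size is $n^{O(\log n)}$.
   Context: Formulae are built from units $\mathsf t,\mathsf f$ and atoms by $[\alpha\vee\beta]$ and $(\alpha\wedge\beta)$. A context $\xi\{\ \}$ is a formula with a hole; a rule with premiss $\alpha$ and conclusion $\beta$ yields steps $\xi\{\gamma\}\to\xi\{\delta\}$ for instances $\gamma,\delta$ of $\alpha,\beta$. A derivation is a chain of steps; size = number of unit and atom occurrences. Rules: $\mathsf{aw}{\downarrow}$: $\mathsf f\to a$; $\mathsf{aw}{\uparrow}$: $a\to\mathsf t$ ($a$ an atom); general weakening $\mathsf w{\downarrow}$: $\mathsf f\to\alpha$ and general coweakening $\mathsf w{\uparrow}$: $\alpha\to\mathsf t$ ($\alpha$ any formula), which can be realised by derivations of atomic weakenings/coweakenings; the rule $=$ replaces a formula by one equal modulo associativity/commutativity of $\vee,\wedge$ and $[\alpha\vee\mathsf f]=\alpha$, $(\alpha\wedge\mathsf t)=\alpha$, $[\mathsf t\vee\mathsf t]=\mathsf t$, $(\mathsf f\wedge\mathsf f)=\mathsf f$ under contexts. A formula used as a derivation denotes the trivial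 derivation. For derivations $\Phi$ from $\alpha$ to $\beta$ and $\Psi$ from $\gamma$ to $\delta$, $[\Phi\vee\Psi]$ (resp. $(\Phi\wedge\Psi)$) denotes the derivation from $[\alpha\vee\gamma]$ to $[\beta\vee\delta]$ (resp. $(\alpha\wedge\gamma)$ to $(\beta\wedge\delta)$) performing $\Phi$ and $\Psi$ inside the respective contexts; $n$-ary versions similarly. $\alpha\{a/\beta\}$ substitutes $\beta$ for all occurrences of atom $a$ (not $\bar a$). Threshold formulae: for $n>0$, distinct (pairwise neither equal nor dual) atoms $a_1,\dots,a_n$, $p=\lfloor n/2\rfloor$, $q=n-p$: $\theta^n_0\equiv\mathsf t$; $\theta^n_k\equiv\mathsf f$ for $k>n$; $\theta^1_1(a_1)\equiv a_1$; for $n>1$, $0<k\le n$: $\theta^n_k(a_1,\dots,a_n)\equiv\bigvee_{i+j=k,0\le i\le p,0\le j\le q}(\theta^p_i(a_1,\dots,a_p)\wedge\theta^q_j(a_{p+1},\dots,a_n))$. Note $\theta^p_p(a_1,\dots,a_p)=(a_1\wedge\dots\wedge a_p)$. For $n>1$, $1\le l\le n$: $\Upsilon^n_{k,l}$ is: if $p\le k\le n$ and $l\le p$, the derivation from $(\theta^p_p(a_1,\dots,a_p)\{a_l/\mathsf f\}\wedge\theta^q_{k-p}(a_{p+1},\dots,a_n))=((a_1\wedge\dots\wedge a_{l-1}\wedge a_{l+1}\wedge\dots\wedge a_p\wedge\theta^q_{k-p}(a_{p+1},\dots,a_n))\wedge\mathsf f)$ to $(\mathsf t\wedge\mathsf f)=\mathsf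 f$ applying $\mathsf w{\uparrow}$ to the first conjunct; if $q\le k\le n$ and $p<l$, the analogous derivation from $(\theta^p_{k-q}(a_1,\dots,a_p)\wedge\theta^q_q(a_{p+1},\dots,a_n)\{a_l/\mathsf f\})$ to $\mathsf f$; otherwise the trivial derivation $\mathsf f$. $\Delta^n_{k,l}$ is: $\mathsf w{\downarrow}$ from $\mathsf f$ to $\theta^q_k(a_{p+1},\dots,a_n)$ if $0<k\le q$ and $l\le p$; $\mathsf w{\downarrow}$ from $\mathsf f$ to $\theta^p_k(a_1,\dots,a_p)$ if $0<k\le p$ and $p<l$; otherwise $\mathsf f$. $\Gamma^n_{k,l}(a_1,\dots,a_n)$ is defined recursively: $\Gamma^1_{0,1}(a_1)=\mathsf t$; $\Gamma^1_{k,1}(a_1)=\mathsf f$ for $k>0$; $\Gamma^n_{k,l}=\mathsf f$ for $k>n$; for $n>1$ and $k\le n$: if $l\le p$, $\Gamma^n_{k,l}=[\bigvee_{i+j=k,0\le i<p,0\le j\le q}(\Gamma^p_{i,l}(a_1,\dots,a_p)\wedge\theta^q_j(a_{p+1},\dots,a_n))\vee\Upsilon^n_{k,l}\vee\Delta^n_{k+1,l}]$; if $p<l$, $\Gamma^n_{k,l}=[\bigvee_{i+j=k,0\le i\le p,0\le j<q}(\theta^p_i(a_1,\dots,a_p)\wedge\Gamma^q_{j,l-p}(a_{p+1},\dots,a_n))\vee\Upsilon^n_{k,l}\vee\Delta^n_{k+1,l}]$. -}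

module Defs where

open import Data.Nat using (ℕ; zero; suc; _+_; _∸_; _≤ᵇ_; _<ᵇ_; ⌊_/2⌋)
open import Data.Nat.Properties using () renaming (_≟_ to _≟ℕ_)
open import Data.Bool using (Bool; true; false; if_then_else_) renaming (_∧_ to _&&_)
open import Data.List using (List; []; _∷_; _++_; length; take; drop; map; upTo; filterᵇ)
open import Data.Nat.ListAction using (sum)
open import Data.Product using (Σ; ∃; ∃-syntax; _×_; _,_)
open import Data.Unit using (⊤; tt)
open import Relation.Binary.PropositionalEquality using (_≡_; refl; cong)
open import Relation.Nullary using (Dec; yes; no)
open import Relation.Binary.Definitions using (DecidableEquality)

-- Atoms.  Variables are natural numbers; an atom is a variable or its
-- dual.  Two atoms are "neither equal nor dual" iff their variables differ.

data Lit : Set where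
  pos : ℕ → Lit
  neg : ℕ → Lit

var : Lit → ℕ
var (pos x) = x
var (neg x) = x

_≟L_ : DecidableEquality Lit
pos x ≟L pos y with x ≟ℕ y
... | yes refl = yes refl
... | no ne = no λ { refl → ne refl }
pos x ≟L neg y = no λ ()
neg x ≟L pos y = no λ ()
neg x ≟L neg y with x ≟ℕ y
... | yes refl = yes refl
... | no ne = no λ { refl → ne refl }

infixr 6 _∧_
infixr 5 _∨_

data Fm : Set where
  𝕥 𝕗 : Fm
  at  : Lit → Fm
  _∨_ : Fm → Fm → Fm
  _∧_ : Fm → Fm → Fm

fsize : Fm → ℕ
fsize 𝕥 = 1
fsize 𝕗 = 1
fsize (at _) = 1
fsize (α ∨ β) = fsize α + fsize β
fsize (α ∧ β) = fsize α + fsize β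

-- α{a/β}: substitute β for every occurrence of the atom a (not of its dual)
_[_≔_] : Fm → Lit → Fm → Fm
𝕥 [ a ≔ β ] = 𝕥
𝕗 [ a ≔ β ] = 𝕗
at b [ a ≔ β ] with a ≟L b
... | yes _ = β
... | no _ = at b
(α ∨ γ) [ a ≔ β ] = (α [ a ≔ β ]) ∨ (γ [ a ≔ β ])
(α ∧ γ) [ a ≔ β ] = (α [ a ≔ β ]) ∧ (γ [ a ≔ β ])

infix 4 _≈_
data _≈_ : Fm → Fm → Set where
  ≈-refl  : ∀ {α} → α ≈ α
  ≈-sym   : ∀ {α β} → α ≈ β → β ≈ α
  ≈-trans : ∀ {α β γ} → α ≈ β → β ≈ γ → α ≈ γ
  ∨-cong  : ∀ {α α' β β'} → α ≈ α' → β ≈ β' → (α ∨ β) ≈ (α' ∨ β')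
  ∧-cong  : ∀ {α α' β β'} → α ≈ α' → β ≈ β' → (α ∧ β) ≈ (α' ∧ β')
  ∨-assoc : ∀ {α β γ} → ((α ∨ β) ∨ γ) ≈ (α ∨ (β ∨ γ))
  ∧-assoc : ∀ {α β γ} → ((α ∧ β) ∧ γ) ≈ (α ∧ (β ∧ γ))
  ∨-comm  : ∀ {α β} → (α ∨ β) ≈ (β ∨ α)
  ∧-comm  : ∀ {α β} → (α ∧ β) ≈ (β ∧ α)
  ∨-unit  : ∀ {α} → (α ∨ 𝕗) ≈ α
  ∧-unit  : ∀ {α} → (α ∧ 𝕥) ≈ α
  tt-eq   : (𝕥 ∨ 𝕥) ≈ 𝕥
  ff-eq   : (𝕗 ∧ 𝕗) ≈ 𝕗

data Ctx : Set where
  ∙    : Ctx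
  _∨ˡ_ : Ctx → Fm → Ctx
  _∨ʳ_ : Fm → Ctx → Ctx
  _∧ˡ_ : Ctx → Fm → Ctx
  _∧ʳ_ : Fm → Ctx → Ctx

plug : Ctx → Fm → Fm
plug ∙ γ = γ
plug (ξ ∨ˡ β) γ = plug ξ γ ∨ β
plug (α ∨ʳ ξ) γ = α ∨ plug ξ γ
plug (ξ ∧ˡ β) γ = plug ξ γ ∧ β
plug (α ∧ʳ ξ) γ = α ∧ plug ξ γ

data Rule : Set where
  aw↓ aw↑ eq : Rule

Step : Rule → Fm → Fm → Set
Step aw↓ φ ψ = Σ Ctx λ ξ → Σ Lit λ a → (φ ≡ plug ξ 𝕗) × (ψ ≡ plug ξ (at a))
Step aw↑ φ ψ = Σ Ctx λ ξ → Σ Lit λ a → (φ ≡ plug ξ (at a)) × (ψ ≡ plug ξ 𝕥)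
Step eq  φ ψ = φ ≈ ψ

-- Derivations as chains of formulae: premiss followed by the later formulae.

record Deriv : Set where
  constructor _⟫_
  field
    prem : Fm
    rest : List Fm
open Deriv public

last : Fm → List Fm → Fm
last φ [] = φ
last φ (ψ ∷ xs) = last ψ xs

concl : Deriv → Fm
concl (φ ⟫ xs) = last φ xs

ValidChain : Fm → List Fm → Set
ValidChain φ [] = ⊤
ValidChain φ (ψ ∷ xs) = (Σ Rule λ r → Step r φ ψ) × ValidChain ψ xs

Valid : Deriv → Set
Valid (φ ⟫ xs) = ValidChain φ xs

size : Deriv → ℕ
size (φ ⟫ xs) = sum (map fsize (φ ∷ xs))

triv : Fm → Deriv
triv φ = φ ⟫ []

step1 : Fm → Fm → Deriv
step1 φ ψ = φ ⟫ (ψ ∷ [])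

-- sequential composition (the premiss of the second is the conclusion of the first)
infixl 3 _⊙_
_⊙_ : Deriv → Deriv → Deriv
(φ ⟫ xs) ⊙ (ψ ⟫ ys) = φ ⟫ (xs ++ ys)

inCtx : (Fm → Fm) → Deriv → Deriv
inCtx c (φ ⟫ xs) = c φ ⟫ map c xs

_∨ᴰ_ : Deriv → Deriv → Deriv
Φ ∨ᴰ Ψ = inCtx (λ x → x ∨ prem Ψ) Φ ⊙ inCtx (λ y → concl Φ ∨ y) Ψ

_∧ᴰ_ : Deriv → Deriv → Deriv
Φ ∧ᴰ Ψ = inCtx (λ x → x ∧ prem Ψ) Φ ⊙ inCtx (λ y → concl Φ ∧ y) Ψ

⋁ : List Fm → Fm
⋁ [] = 𝕗
⋁ (x ∷ []) = x
⋁ (x ∷ y ∷ xs) = x ∨ ⋁ (y ∷ xs)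

⋀ : List Fm → Fm
⋀ [] = 𝕥
⋀ (x ∷ []) = x
⋀ (x ∷ y ∷ xs) = x ∧ ⋀ (y ∷ xs)

⋁ᴰ : List Deriv → Deriv
⋁ᴰ [] = triv 𝕗
⋁ᴰ (x ∷ []) = x
⋁ᴰ (x ∷ y ∷ xs) = x ∨ᴰ ⋁ᴰ (y ∷ xs)

-- General weakening f → α and coweakening α → t realised by atomic
-- (co)weakenings and =.  (Weakening f → t and coweakening f → t are not realisable
-- in this way; they never occur in Γ, and are given trivial derivations.)

wk : Fm → Deriv
wk 𝕗 = triv 𝕗
wk 𝕥 = triv 𝕥
wk (at a) = step1 𝕗 (at a)
wk (α ∨ β) = step1 𝕗 (𝕗 ∨ 𝕗) ⊙ (wk α ∨ᴰ wk β)
wk (𝕥 ∧ β) = wk β ⊙ step1 β (𝕥 ∧ β)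
wk (α ∧ 𝕥) = wk α ⊙ step1 α (α ∧ 𝕥)
wk (α ∧ β) = step1 𝕗 (𝕗 ∧ 𝕗) ⊙ (wk α ∧ᴰ wk β)

cowk : Fm → Deriv
cowk 𝕥 = triv 𝕥
cowk 𝕗 = triv 𝕗
cowk (at a) = step1 (at a) 𝕥
cowk (α ∨ β) = (cowk α ∨ᴰ cowk β) ⊙ step1 (𝕥 ∨ 𝕥) 𝕥
cowk (α ∧ β) = (cowk α ∧ᴰ cowk β) ⊙ step1 (𝕥 ∧ 𝕥) 𝕥

-- Threshold formulae θ^n_k(a₁,…,aₙ), atoms given as a list of length n.
-- Defined with a fuel argument (the list length suffices, since each
-- recursive call is on a strictly shorter list).

idx : ℕ → ℕ → ℕ → List ℕ
idx m r k = filterᵇ (λ i → (i ≤ᵇ k) && ((k ∸ i) ≤ᵇ r)) (upTo m)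

θf : ℕ → List Lit → ℕ → Fm
θf _ as zero = 𝕥
θf _ [] (suc k) = 𝕗
θf _ (a ∷ []) (suc zero) = at a
θf _ (a ∷ []) (suc (suc k)) = 𝕗
θf zero (a ∷ b ∷ as) (suc k) = 𝕗
θf (suc fuel) as@(a ∷ b ∷ _) k@(suc _) =
  if length as <ᵇ k then 𝕗
  else ⋁ (map (λ i → θf fuel xs i ∧ θf fuel ys (k ∸ i)) (idx (suc p) q k))
  where
    p = ⌊ length as /2⌋
    q = length as ∸ p
    xs = take p as
    ys = drop p as

θ : List Lit → ℕ → Fm
θ as k = θf (length as) as k

-- Position-based helpers (positions are 1-based, as in the paper).

nth : List Lit → ℕ → Lit
nth [] _ = pos 0
nth (a ∷ as) zero = a
nth (a ∷ as) (suc zero) = a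
nth (a ∷ as) (suc (suc l)) = nth as (suc l)

removeNth : ℕ → List Lit → List Lit
removeNth _ [] = []
removeNth zero (x ∷ xs) = x ∷ xs
removeNth (suc zero) (x ∷ xs) = xs
removeNth (suc (suc l)) (x ∷ xs) = x ∷ removeNth (suc l) xs

Υ : List Lit → ℕ → ℕ → Deriv
Υ as k l =
  if (l ≤ᵇ p) && ((p ≤ᵇ k) && (k ≤ᵇ n)) then
    (step1 ((θ xs p [ nth as l ≔ 𝕗 ]) ∧ θ ys (k ∸ p)) (R₁ ∧ 𝕗)
      ⊙ (cowk R₁ ∧ᴰ triv 𝕗) ⊙ step1 (𝕥 ∧ 𝕗) 𝕗)
  else if (p <ᵇ l) && ((q ≤ᵇ k) && (k ≤ᵇ n)) then
    (step1 (θ xs (k ∸ q) ∧ (θ ys q [ nth as l ≔ 𝕗 ])) (R₂ ∧ 𝕗)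
      ⊙ (cowk R₂ ∧ᴰ triv 𝕗) ⊙ step1 (𝕥 ∧ 𝕗) 𝕗)
  else triv 𝕗
  where
    n = length as
    p = ⌊ n /2⌋
    q = n ∸ p
    xs = take p as
    ys = drop p as
    R₁ = ⋀ (map at (removeNth l xs) ++ (θ ys (k ∸ p) ∷ []))
    R₂ = ⋀ (θ xs (k ∸ q) ∷ map at (removeNth (l ∸ p) ys))

Δ : List Lit → ℕ → ℕ → Deriv
Δ as k l =
  if (1 ≤ᵇ k) && ((k ≤ᵇ q) && (l ≤ᵇ p)) then wk (θ ys k)
  else if (1 ≤ᵇ k) && ((k ≤ᵇ p) && (p <ᵇ l)) then wk (θ xs k)
  else triv 𝕗
  where
    n = length as
    p = ⌊ n /2⌋
    q = n ∸ p
    xs = take p as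
    ys = drop p as

Γf : ℕ → List Lit → ℕ → ℕ → Deriv
Γf _ [] k l = triv 𝕗
Γf _ (a ∷ []) zero l = triv 𝕥
Γf _ (a ∷ []) (suc k) l = triv 𝕗
Γf zero (a ∷ b ∷ _) k l = triv 𝕗
Γf (suc fuel) as@(a ∷ b ∷ _) k l =
  if n <ᵇ k then triv 𝕗
  else if l ≤ᵇ p then
    ⋁ᴰ (map (λ i → Γf fuel xs i l ∧ᴰ triv (θ ys (k ∸ i))) (idx p q k)
        ++ (Υ as k l ∷ Δ as (suc k) l ∷ []))
  else
    ⋁ᴰ (map (λ i → triv (θ xs i) ∧ᴰ Γf fuel ys (k ∸ i) (l ∸ p)) (idx (suc p) (q ∸ 1) k)
        ++ (Υ as k l ∷ Δ as (suc k) l ∷ []))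
  where
    n = length as
    p = ⌊ n /2⌋
    q = n ∸ p
    xs = take p as
    ys = drop p as

Γ : List Lit → ℕ → ℕ → Deriv
Γ as k l = Γf (length as) as k l

module Submission where

-- θ and Γ both recurse on the halves of the atom list (p = ⌊n/2⌋ and q = n - p
-- atoms), so every induction below is an instance of halving-induction.
-- Correctness (Γ-correct): if a_l is in the left half, the branches of Γ turn
-- the summand (i, k - i) into (i + 1, k - i), Υ accounts for i = p and Δ for the
-- new summand i = 0; symmetrically on the right.  Size (Γ-cost): width and
-- number of steps of Γ over at most min(n, 2^d) atoms are at most n^{7d}, so
-- the size is at most 2·n^{14d}; d = ⌊log₂ n⌋ + 1 gives the theorem with c = 14.

open import Defs
open import Data.Nat
  using (ℕ; zero; suc; _+_; _*_; _∸_; _^_; _≤_; _<_; z≤n; s≤s; _≤ᵇ_; _<ᵇ_; _≡ᵇ_; ⌊_/2⌋; ⌈_/2⌉; _≤?_; _<?_)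
open import Data.Nat.Properties
open import Data.Nat.ListAction using (sum)
open import Data.Nat.ListAction.Properties using (sum-++)
open import Data.Nat.Logarithm using (⌊log₂_⌋; ⌊log₂⌋-mono-≤; ⌊log₂[2^n]⌋≡n)
open import Data.Nat.Tactic.RingSolver using (solve-∀)
open import Data.Bool using (Bool; true; false; if_then_else_; T) renaming (_∧_ to _&&_)
open import Data.Bool.Properties using (∧-zeroʳ; ∧-identityʳ; T-∧; T?)
open import Data.List using (List; []; _∷_; _++_; length; map; upTo; applyUpTo; filterᵇ; take; drop)
open import Data.List.Properties
  using (length-++; length-map; map-++; upTo-∷ʳ; map-upTo; map-applyUpTo; length-take; length-drop;
         take++drop≡id; map-cong; map-∘; length-filter; length-upTo)
open import Data.List.Relation.Unary.All as All using (All; []; _∷_)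
open import Data.List.Relation.Unary.All.Properties
  using (++⁺; map⁺; ++⁻ʳ; take⁺; drop⁺; all-upTo; all-filter; filter⁺)
open import Data.List.Relation.Unary.AllPairs using (AllPairs; []; _∷_)
import Data.List.Relation.Unary.AllPairs.Properties as AllPairs
open import Data.List.Relation.Unary.Unique.Propositional using (Unique)
open import Data.List.Relation.Unary.Any using (here; there)
open import Data.List.Membership.Propositional using (_∈_)
open import Data.List.Membership.Propositional.Properties using (∈-filter⁺; ∈-upTo⁺)
open import Data.Product using (∃-syntax; _×_; _,_; proj₁; proj₂)
open import Data.Sum using (inj₁; inj₂)
open import Data.Unit using (tt)
open import Data.Empty using (⊥-elim)
open import Function using (_∘_)
open import Function.Bundles using (Equivalence)
open import Relation.Nullary using (yes; no; ¬_)
open import Relation.Binary.Definitions using (tri<; tri≈; tri>)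
open import Relation.Binary.PropositionalEquality

infixr 1 _⟨≈⟩_
_⟨≈⟩_ : ∀ {α β γ} → α ≈ β → β ≈ γ → α ≈ γ
_⟨≈⟩_ = ≈-trans

≡⇒≈ : ∀ {α β} → α ≡ β → α ≈ β
≡⇒≈ refl = ≈-refl

𝕗∨-unit : ∀ {α} → (𝕗 ∨ α) ≈ α
𝕗∨-unit = ∨-comm ⟨≈⟩ ∨-unit

𝕥∧-unit : ∀ {α} → (𝕥 ∧ α) ≈ α
𝕥∧-unit = ∧-comm ⟨≈⟩ ∧-unit

∨-interchange : ∀ {α β γ δ} → ((α ∨ β) ∨ (γ ∨ δ)) ≈ ((α ∨ γ) ∨ (β ∨ δ))
∨-interchange = ∨-assoc ⟨≈⟩ ∨-cong ≈-refl (≈-sym ∨-assoc ⟨≈⟩ ∨-cong ∨-comm ≈-refl ⟨≈⟩ ∨-assoc)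
                ⟨≈⟩ ≈-sym ∨-assoc

-- The n-ary ⋁ and ⋀ of Defs unfold uniformly, up to =, also at the last element.
⋁-cons : ∀ φ φs → ⋁ (φ ∷ φs) ≈ (φ ∨ ⋁ φs)
⋁-cons φ [] = ≈-sym ∨-unit
⋁-cons φ (_ ∷ _) = ≈-refl

⋀-cons : ∀ φ φs → ⋀ (φ ∷ φs) ≈ (φ ∧ ⋀ φs)
⋀-cons φ [] = ≈-sym ∧-unit
⋀-cons φ (_ ∷ _) = ≈-refl

⋁-++ : ∀ φs ψs → ⋁ (φs ++ ψs) ≈ (⋁ φs ∨ ⋁ ψs)
⋁-++ [] ψs = ≈-sym 𝕗∨-unit
⋁-++ (φ ∷ φs) ψs = ⋁-cons φ (φs ++ ψs) ⟨≈⟩ ∨-cong ≈-refl (⋁-++ φs ψs) ⟨≈⟩ ≈-sym ∨-assoc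
                   ⟨≈⟩ ∨-cong (≈-sym (⋁-cons φ φs)) ≈-refl

⋀-++ : ∀ φs ψs → ⋀ (φs ++ ψs) ≈ (⋀ φs ∧ ⋀ ψs)
⋀-++ [] ψs = ≈-sym 𝕥∧-unit
⋀-++ (φ ∷ φs) ψs = ⋀-cons φ (φs ++ ψs) ⟨≈⟩ ∧-cong ≈-refl (⋀-++ φs ψs) ⟨≈⟩ ≈-sym ∧-assoc
                   ⟨≈⟩ ∧-cong (≈-sym (⋀-cons φ φs)) ≈-refl

⋁-map-cong : ∀ {A : Set} {T U : A → Fm} xs → (∀ x → T x ≈ U x) → ⋁ (map T xs) ≈ ⋁ (map U xs)
⋁-map-cong [] _ = ≈-refl
⋁-map-cong (x ∷ []) T≈U = T≈U x
⋁-map-cong (x ∷ y ∷ xs) T≈U = ∨-cong (T≈U x) (⋁-map-cong (y ∷ xs) T≈U)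

-- Exactly d φ ψ pins down premiss and conclusion
-- syntactically, which is what sequential composition needs; Derives d φ ψ
-- only up to =, which is what the theorem asks for.

last-++ : ∀ φ xs ys → last φ (xs ++ ys) ≡ last (last φ xs) ys
last-++ φ [] ys = refl
last-++ φ (x ∷ xs) ys = last-++ x xs ys

validChain-++ : ∀ φ xs ys → ValidChain φ xs → ValidChain (last φ xs) ys → ValidChain φ (xs ++ ys)
validChain-++ φ [] ys _ w = w
validChain-++ φ (x ∷ xs) ys (s , v) w = s , validChain-++ x xs ys v w

StepPreserving : (Fm → Fm) → Set
StepPreserving c = ∀ {r φ ψ} → Step r φ ψ → Step r (c φ) (c ψ)

contextual : (c : Fm → Fm) (extend : Ctx → Ctx) → (∀ ξ γ → c (plug ξ γ) ≡ plug (extend ξ) γ) →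
             (∀ {φ ψ} → φ ≈ ψ → c φ ≈ c ψ) → StepPreserving c
contextual c extend plugs _ {aw↓} (ξ , a , refl , refl) = extend ξ , a , plugs ξ 𝕗 , plugs ξ (at a)
contextual c extend plugs _ {aw↑} (ξ , a , refl , refl) = extend ξ , a , plugs ξ (at a) , plugs ξ 𝕥
contextual c extend plugs ≈-c {eq} s = ≈-c s

record Connective (_⊕_ : Fm → Fm → Fm) : Set where
  field
    inLeft   : ∀ β → StepPreserving (_⊕ β)
    inRight  : ∀ α → StepPreserving (α ⊕_)
    additive : ∀ α β → fsize (α ⊕ β) ≡ fsize α + fsize β
    respects : ∀ {α α' β β'} → α ≈ α' → β ≈ β' → (α ⊕ β) ≈ (α' ⊕ β')
open Connective

∨-connective : Connective _∨_
∨-connective = record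
  { inLeft   = λ β → contextual (_∨ β) (_∨ˡ β) (λ _ _ → refl) (λ e → ∨-cong e ≈-refl)
  ; inRight  = λ α → contextual (α ∨_) (α ∨ʳ_) (λ _ _ → refl) (∨-cong ≈-refl)
  ; additive = λ _ _ → refl
  ; respects = ∨-cong }

∧-connective : Connective _∧_
∧-connective = record
  { inLeft   = λ β → contextual (_∧ β) (_∧ˡ β) (λ _ _ → refl) (λ e → ∧-cong e ≈-refl)
  ; inRight  = λ α → contextual (α ∧_) (α ∧ʳ_) (λ _ _ → refl) (∧-cong ≈-refl)
  ; additive = λ _ _ → refl
  ; respects = ∧-cong }

-- [Φ ⊕ Ψ]: Φ in the left context, then Ψ in the right one.  By definition
-- Φ ∨ᴰ Ψ is parallel _∨_ Φ Ψ and Φ ∧ᴰ Ψ is parallel _∧_ Φ Ψ.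
parallel : (Fm → Fm → Fm) → Deriv → Deriv → Deriv
parallel _⊕_ Φ Ψ = inCtx (λ x → x ⊕ prem Ψ) Φ ⊙ inCtx (λ y → concl Φ ⊕ y) Ψ

record Exactly (d : Deriv) (φ ψ : Fm) : Set where
  constructor exactly
  field
    valid      : Valid d
    premiss    : prem d ≡ φ
    conclusion : concl d ≡ ψ
open Exactly

record Derives (d : Deriv) (φ ψ : Fm) : Set where
  constructor derives
  field
    valid≈      : Valid d
    premiss≈    : prem d ≈ φ
    conclusion≈ : concl d ≈ ψ
open Derives

trivial-exact : ∀ φ → Exactly (triv φ) φ φ
trivial-exact φ = exactly tt refl refl

step-exact : ∀ r {φ ψ} → Step r φ ψ → Exactly (step1 φ ψ) φ ψ
step-exact r s = exactly ((r , s) , tt) refl refl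

⊙-exact : ∀ {d e φ ψ χ} → Exactly d φ ψ → Exactly e ψ χ → Exactly (d ⊙ e) φ χ
⊙-exact {φ ⟫ xs} {.ψ ⟫ ys} {ψ = ψ} (exactly v refl c) (exactly w refl c') =
  exactly (validChain-++ φ xs ys v (subst (λ z → ValidChain z ys) (sym c) w)) refl
          (trans (last-++ φ xs ys) (trans (cong (λ z → last z ys) c) c'))

inCtx-exact : ∀ {c d φ ψ} → StepPreserving c → Exactly d φ ψ → Exactly (inCtx c d) (c φ) (c ψ)
inCtx-exact {c} {φ ⟫ xs} sp (exactly v refl refl) = exactly (lift φ xs v) refl (lift-last φ xs)
  where
  lift : ∀ φ xs → ValidChain φ xs → ValidChain (c φ) (map c xs)
  lift φ [] _ = tt
  lift φ (x ∷ xs) ((r , s) , v) = (r , sp s) , lift x xs v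
  lift-last : ∀ φ xs → last (c φ) (map c xs) ≡ c (last φ xs)
  lift-last φ [] = refl
  lift-last φ (x ∷ xs) = lift-last x xs

parallel-exact : ∀ {_⊕_} → Connective _⊕_ → ∀ {Φ Ψ α β γ δ} →
                 Exactly Φ α β → Exactly Ψ γ δ → Exactly (parallel _⊕_ Φ Ψ) (α ⊕ γ) (β ⊕ δ)
parallel-exact {_⊕_} con {Φ} {Ψ} eΦ@(exactly _ _ refl) eΨ@(exactly _ refl _) =
  ⊙-exact (inCtx-exact (inLeft con (prem Ψ)) eΦ) (inCtx-exact (inRight con (concl Φ)) eΨ)

⋁ᴰ-exact : ∀ ds → All Valid ds → Exactly (⋁ᴰ ds) (⋁ (map prem ds)) (⋁ (map concl ds))
⋁ᴰ-exact [] [] = trivial-exact 𝕗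
⋁ᴰ-exact (d ∷ []) (v ∷ []) = exactly v refl refl
⋁ᴰ-exact (d ∷ e ∷ ds) (v ∷ vs) = parallel-exact ∨-connective (exactly v refl refl) (⋁ᴰ-exact (e ∷ ds) vs)

exact⇒derives : ∀ {d φ ψ φ' ψ'} → Exactly d φ ψ → φ ≈ φ' → ψ ≈ ψ' → Derives d φ' ψ'
exact⇒derives (exactly v refl refl) φ≈φ' ψ≈ψ' = derives v φ≈φ' ψ≈ψ'

derives-≈ : ∀ {d φ ψ φ' ψ'} → Derives d φ ψ → φ ≈ φ' → ψ ≈ ψ' → Derives d φ' ψ'
derives-≈ (derives v p c) φ≈φ' ψ≈ψ' = derives v (p ⟨≈⟩ φ≈φ') (c ⟨≈⟩ ψ≈ψ')

trivial-derives : ∀ φ → Derives (triv φ) φ φ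
trivial-derives φ = derives tt ≈-refl ≈-refl

parallel-derives : ∀ {_⊕_} → Connective _⊕_ → ∀ {Φ Ψ α β γ δ} →
                   Derives Φ α β → Derives Ψ γ δ → Derives (parallel _⊕_ Φ Ψ) (α ⊕ γ) (β ⊕ δ)
parallel-derives con (derives v p c) (derives w p' c') =
  exact⇒derives (parallel-exact con (exactly v refl refl) (exactly w refl refl)) (respects con p p') (respects con c c')

⋁ᴰ-derives : ∀ (G : ℕ → Deriv) {P C : ℕ → Fm} is {Y Z φY ψY φZ ψZ} →
  (∀ i → Derives (G i) (P i) (C i)) → Derives Y φY ψY → Derives Z φZ ψZ →
  Derives (⋁ᴰ (map G is ++ (Y ∷ Z ∷ []))) (⋁ (map P is) ∨ (φY ∨ φZ)) (⋁ (map C is) ∨ (ψY ∨ ψZ))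
⋁ᴰ-derives G {P} {C} is {Y} {Z} dG dY dZ =
  exact⇒derives (⋁ᴰ-exact ds (++⁺ (valids is) (valid≈ dY ∷ valid≈ dZ ∷ [])))
    (split prem ⟨≈⟩ ∨-cong (⋁-map-cong is (premiss≈ ∘ dG)) (∨-cong (premiss≈ dY) (premiss≈ dZ)))
    (split concl ⟨≈⟩ ∨-cong (⋁-map-cong is (conclusion≈ ∘ dG)) (∨-cong (conclusion≈ dY) (conclusion≈ dZ)))
  where
  ds : List Deriv
  ds = map G is ++ (Y ∷ Z ∷ [])
  valids : ∀ is → All Valid (map G is)
  valids [] = []
  valids (i ∷ is) = valid≈ (dG i) ∷ valids is
  split : ∀ (end : Deriv → Fm) → ⋁ (map end ds) ≈ (⋁ (map (end ∘ G) is) ∨ (end Y ∨ end Z))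
  split end = ≡⇒≈ (cong ⋁ (map-++ end (map G is) (Y ∷ Z ∷ []))) ⟨≈⟩
              ⋁-++ (map end (map G is)) (end Y ∷ end Z ∷ []) ⟨≈⟩
              ∨-cong (≡⇒≈ (cong ⋁ (sym (map-∘ is)))) ≈-refl

formulae : Deriv → List Fm
formulae d = prem d ∷ rest d

Width : ℕ → Deriv → Set
Width W d = All (λ φ → fsize φ ≤ W) (formulae d)

steps : Deriv → ℕ
steps d = length (rest d)

fsize≥1 : ∀ α → 1 ≤ fsize α
fsize≥1 𝕥 = s≤s z≤n
fsize≥1 𝕗 = s≤s z≤n
fsize≥1 (at _) = s≤s z≤n
fsize≥1 (α ∨ β) = ≤-trans (fsize≥1 α) (m≤m+n _ _)
fsize≥1 (α ∧ β) = ≤-trans (fsize≥1 α) (m≤m+n _ _)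

width-mono : ∀ {V W} d → V ≤ W → Width V d → Width W d
width-mono d V≤W = All.map (λ h → ≤-trans h V≤W)

width-⊙ : ∀ {W} d e → Width W d → Width W e → Width W (d ⊙ e)
width-⊙ d e (h ∷ hs) (_ ∷ ks) = h ∷ ++⁺ hs ks

steps-⊙ : ∀ d e → steps (d ⊙ e) ≡ steps d + steps e
steps-⊙ d e = length-++ (rest d)

width-concl : ∀ {W} d → Width W d → fsize (concl d) ≤ W
width-concl (φ ⟫ xs) = go φ xs
  where
  go : ∀ {W} φ xs → All (λ φ → fsize φ ≤ W) (φ ∷ xs) → fsize (last φ xs) ≤ W
  go φ [] (h ∷ []) = h
  go φ (x ∷ xs) (_ ∷ hs) = go x xs hs

-- Parallel composition: every formula is φ ⊕ ψ with φ from Φ and ψ from Ψ.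
width-parallel : ∀ {_⊕_} → Connective _⊕_ → ∀ {a b} Φ Ψ → Width a Φ → Width b Ψ →
                 Width (a + b) (parallel _⊕_ Φ Ψ)
width-parallel {_⊕_} con Φ Ψ wΦ@(h ∷ hs) wΨ@(k ∷ ks) =
  bound h k ∷ ++⁺ (map⁺ (All.map (λ h' → bound h' k) hs))
                  (map⁺ (All.map (bound (width-concl Φ wΦ)) ks))
  where
  bound : ∀ {α β a b} → fsize α ≤ a → fsize β ≤ b → fsize (α ⊕ β) ≤ a + b
  bound {α} {β} hα hβ = ≤-trans (≤-reflexive (additive con α β)) (+-mono-≤ hα hβ)

steps-parallel : ∀ _⊕_ Φ Ψ → steps (parallel _⊕_ Φ Ψ) ≡ steps Φ + steps Ψ
steps-parallel _⊕_ Φ Ψ =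
  trans (length-++ (map (λ x → x ⊕ prem Ψ) (rest Φ))) (cong₂ _+_ (length-map _ (rest Φ)) (length-map _ (rest Ψ)))

size≤ : ∀ {W} d → Width W d → size d ≤ suc (steps d) * W
size≤ {W} d = go (formulae d)
  where
  go : ∀ φs → All (λ φ → fsize φ ≤ W) φs → sum (map fsize φs) ≤ length φs * W
  go [] [] = z≤n
  go (φ ∷ φs) (h ∷ hs) = +-mono-≤ h (go φs hs)

record Cost (B : ℕ) (d : Deriv) : Set where
  constructor cost
  field
    cost-width : Width B d
    cost-steps : steps d ≤ B
open Cost

cost-mono : ∀ {A B} d → A ≤ B → Cost A d → Cost B d
cost-mono d A≤B (cost w s) = cost (width-mono d A≤B w) (≤-trans s A≤B)

trivial-cost : ∀ {B} φ → fsize φ ≤ B → Cost B (triv φ)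
trivial-cost φ h = cost (h ∷ []) z≤n

-- A disjunction of m derivations of cost B costs at most 1 + m·B
-- (the extra unit accounts for the 𝕗 of the empty disjunction).
⋁ᴰ-cost : ∀ {B} ds → All (Cost B) ds → Cost (1 + length ds * B) (⋁ᴰ ds)
⋁ᴰ-cost [] [] = cost (s≤s z≤n ∷ []) z≤n
⋁ᴰ-cost {B} (d ∷ []) (c ∷ []) = cost-mono d (≤-trans (m≤n+m B 1) (+-monoʳ-≤ 1 (≤-reflexive (sym (+-identityʳ B))))) c
⋁ᴰ-cost {B} (d ∷ e ∷ ds) (c ∷ cs) with ⋁ᴰ-cost (e ∷ ds) cs
... | cost w s = cost (subst (λ W → Width W (d ∨ᴰ ⋁ᴰ (e ∷ ds))) (+-suc B _) (width-parallel ∨-connective d _ (cost-width c) w))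
                      (≤-trans (≤-reflexive (steps-parallel _∨_ d _))
                        (≤-trans (+-mono-≤ (cost-steps c) s) (≤-reflexive (+-suc B _))))

-- Formulae without 𝕗: exactly those that cowk collapses to 𝕥.
data FalseFree : Fm → Set where
  ff-𝕥 : FalseFree 𝕥
  ff-at : ∀ a → FalseFree (at a)
  ff-∨ : ∀ {α β} → FalseFree α → FalseFree β → FalseFree (α ∨ β)
  ff-∧ : ∀ {α β} → FalseFree α → FalseFree β → FalseFree (α ∧ β)

-- Formulae built from atoms in which 𝕥 only occurs as one side of a
-- conjunction: exactly those that wk produces from 𝕗.
data Weakenable : Fm → Set where
  w-at : ∀ a → Weakenable (at a)
  w-∨ : ∀ {α β} → Weakenable α → Weakenable β → Weakenable (α ∨ β)
  w-𝕥∧ : ∀ {β} → Weakenable β → Weakenable (𝕥 ∧ β)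
  w-∧𝕥 : ∀ {α} → Weakenable α → Weakenable (α ∧ 𝕥)
  w-∧ : ∀ {α β} → Weakenable α → Weakenable β → Weakenable (α ∧ β)

steps-join : ∀ a b {x y} → x < 2 * a → y < 2 * b → suc (x + y) < 2 * (a + b)
steps-join a b {x} {y} hx hy = begin-strict
  suc (x + y)   <⟨ s≤s (≤-reflexive (sym (+-suc x y))) ⟩
  suc x + suc y ≤⟨ +-mono-≤ hx hy ⟩
  2 * a + 2 * b ≡⟨ *-distribˡ-+ 2 a b ⟨
  2 * (a + b)   ∎
  where open ≤-Reasoning

two-units : ∀ α β → 2 ≤ fsize α + fsize β
two-units α β = +-mono-≤ (fsize≥1 α) (fsize≥1 β)

cowk-exact : ∀ {α} → FalseFree α → Exactly (cowk α) α 𝕥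
cowk-exact ff-𝕥 = trivial-exact 𝕥
cowk-exact (ff-at a) = step-exact aw↑ (∙ , a , refl , refl)
cowk-exact (ff-∨ h k) = ⊙-exact (parallel-exact ∨-connective (cowk-exact h) (cowk-exact k)) (step-exact eq tt-eq)
cowk-exact (ff-∧ h k) = ⊙-exact (parallel-exact ∧-connective (cowk-exact h) (cowk-exact k)) (step-exact eq ∧-unit)

cowk-width : ∀ {α} → FalseFree α → Width (fsize α) (cowk α)
cowk-width ff-𝕥 = ≤-refl ∷ []
cowk-width (ff-at a) = ≤-refl ∷ ≤-refl ∷ []
cowk-width (ff-∨ {α} {β} h k) =
  width-⊙ (cowk α ∨ᴰ cowk β) (step1 (𝕥 ∨ 𝕥) 𝕥) (width-parallel ∨-connective _ _ (cowk-width h) (cowk-width k))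
          (two-units α β ∷ ≤-trans (s≤s z≤n) (two-units α β) ∷ [])
cowk-width (ff-∧ {α} {β} h k) =
  width-⊙ (cowk α ∧ᴰ cowk β) (step1 (𝕥 ∧ 𝕥) 𝕥) (width-parallel ∧-connective _ _ (cowk-width h) (cowk-width k))
          (two-units α β ∷ ≤-trans (s≤s z≤n) (two-units α β) ∷ [])

steps-parallel-then-step : ∀ _⊕_ Φ Ψ φ ψ → steps (parallel _⊕_ Φ Ψ ⊙ step1 φ ψ) ≡ suc (steps Φ + steps Ψ)
steps-parallel-then-step _⊕_ Φ Ψ φ ψ =
  trans (steps-⊙ (parallel _⊕_ Φ Ψ) (step1 φ ψ)) (trans (cong (_+ 1) (steps-parallel _⊕_ Φ Ψ)) (+-comm _ 1))

cowk-steps : ∀ {α} → FalseFree α → steps (cowk α) < 2 * fsize α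
cowk-steps ff-𝕥 = s≤s z≤n
cowk-steps (ff-at a) = s≤s (s≤s z≤n)
cowk-steps (ff-∨ {α} {β} h k) = subst (_< 2 * (fsize α + fsize β))
  (sym (steps-parallel-then-step _∨_ (cowk α) (cowk β) (𝕥 ∨ 𝕥) 𝕥))
  (steps-join (fsize α) (fsize β) (cowk-steps h) (cowk-steps k))
cowk-steps (ff-∧ {α} {β} h k) = subst (_< 2 * (fsize α + fsize β))
  (sym (steps-parallel-then-step _∧_ (cowk α) (cowk β) (𝕥 ∧ 𝕥) 𝕥))
  (steps-join (fsize α) (fsize β) (cowk-steps h) (cowk-steps k))

-- Non-unit formulae: for these the overlapping clauses of wk on
-- conjunctions reduce as expected.
data NonUnit : Fm → Set where
  nu-at : ∀ a → NonUnit (at a)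
  nu-∨ : ∀ α β → NonUnit (α ∨ β)
  nu-∧ : ∀ α β → NonUnit (α ∧ β)

nonUnit : ∀ {α} → Weakenable α → NonUnit α
nonUnit (w-at a) = nu-at a
nonUnit (w-∨ _ _) = nu-∨ _ _
nonUnit (w-𝕥∧ _) = nu-∧ _ _
nonUnit (w-∧𝕥 _) = nu-∧ _ _
nonUnit (w-∧ _ _) = nu-∧ _ _

wk-∧𝕥 : ∀ {α} → NonUnit α → wk (α ∧ 𝕥) ≡ (wk α ⊙ step1 α (α ∧ 𝕥))
wk-∧𝕥 (nu-at a) = refl
wk-∧𝕥 (nu-∨ α β) = refl
wk-∧𝕥 (nu-∧ α β) = refl

wk-∧ : ∀ {α β} → NonUnit α → NonUnit β → wk (α ∧ β) ≡ (step1 𝕗 (𝕗 ∧ 𝕗) ⊙ (wk α ∧ᴰ wk β))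
wk-∧ (nu-at a) (nu-at b) = refl
wk-∧ (nu-at a) (nu-∨ _ _) = refl
wk-∧ (nu-at a) (nu-∧ _ _) = refl
wk-∧ (nu-∨ _ _) (nu-at b) = refl
wk-∧ (nu-∨ _ _) (nu-∨ _ _) = refl
wk-∧ (nu-∨ _ _) (nu-∧ _ _) = refl
wk-∧ (nu-∧ _ _) (nu-at b) = refl
wk-∧ (nu-∧ _ _) (nu-∨ _ _) = refl
wk-∧ (nu-∧ _ _) (nu-∧ _ _) = refl

wk-exact : ∀ {α} → Weakenable α → Exactly (wk α) 𝕗 α
wk-exact (w-at a) = step-exact aw↓ (∙ , a , refl , refl)
wk-exact (w-∨ h k) = ⊙-exact (step-exact eq (≈-sym ∨-unit)) (parallel-exact ∨-connective (wk-exact h) (wk-exact k))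
wk-exact (w-𝕥∧ h) = ⊙-exact (wk-exact h) (step-exact eq (≈-sym 𝕥∧-unit))
wk-exact (w-∧𝕥 h) rewrite wk-∧𝕥 (nonUnit h) = ⊙-exact (wk-exact h) (step-exact eq (≈-sym ∧-unit))
wk-exact (w-∧ h k) rewrite wk-∧ (nonUnit h) (nonUnit k) =
  ⊙-exact (step-exact eq (≈-sym ff-eq)) (parallel-exact ∧-connective (wk-exact h) (wk-exact k))

wk-width : ∀ {α} → Weakenable α → Width (fsize α) (wk α)
wk-width (w-at a) = ≤-refl ∷ ≤-refl ∷ []
wk-width (w-∨ {α} {β} h k) =
  ≤-trans (s≤s z≤n) (two-units α β) ∷ two-units α β ∷ All.tail (width-parallel ∨-connective _ _ (wk-width h) (wk-width k))
wk-width (w-𝕥∧ {β} h) =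
  width-⊙ (wk β) (step1 β (𝕥 ∧ β)) (width-mono (wk β) (n≤1+n _) (wk-width h)) (n≤1+n _ ∷ ≤-refl ∷ [])
wk-width (w-∧𝕥 {α} h) rewrite wk-∧𝕥 (nonUnit h) =
  width-⊙ (wk α) (step1 α (α ∧ 𝕥)) (width-mono (wk α) (m≤m+n _ 1) (wk-width h)) (m≤m+n _ 1 ∷ ≤-refl ∷ [])
wk-width (w-∧ {α} {β} h k) rewrite wk-∧ (nonUnit h) (nonUnit k) =
  ≤-trans (s≤s z≤n) (two-units α β) ∷ two-units α β ∷ All.tail (width-parallel ∧-connective _ _ (wk-width h) (wk-width k))

steps-extend : ∀ b {x} → x < 2 * b → x + 1 < 2 * (b + 1)
steps-extend b {x} hx = subst (x + 1 <_) (sym (*-distribˡ-+ 2 b 1)) (+-mono-≤ hx (s≤s z≤n))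

wk-steps : ∀ {α} → Weakenable α → steps (wk α) < 2 * fsize α
wk-steps (w-at a) = s≤s (s≤s z≤n)
wk-steps (w-∨ {α} {β} h k) rewrite steps-parallel _∨_ (wk α) (wk β) =
  steps-join (fsize α) (fsize β) (wk-steps h) (wk-steps k)
wk-steps (w-𝕥∧ {β} h) rewrite steps-⊙ (wk β) (step1 β (𝕥 ∧ β)) =
  subst (λ s → steps (wk β) + 1 < 2 * s) (+-comm (fsize β) 1) (steps-extend (fsize β) (wk-steps h))
wk-steps (w-∧𝕥 {α} h) rewrite wk-∧𝕥 (nonUnit h) | steps-⊙ (wk α) (step1 α (α ∧ 𝕥)) =
  steps-extend (fsize α) (wk-steps h)
wk-steps (w-∧ {α} {β} h k) rewrite wk-∧ (nonUnit h) (nonUnit k) | steps-parallel _∧_ (wk α) (wk β) =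
  steps-join (fsize α) (fsize β) (wk-steps h) (wk-steps k)

wk-cost : ∀ {α N} → Weakenable α → fsize α ≤ N → Cost (N + N) (wk α)
wk-cost {α} {N} h α≤N = cost (width-mono (wk α) (≤-trans α≤N (m≤m+n N N)) (wk-width h))
                             (≤-trans (<⇒≤ (wk-steps h)) (≤-trans (*-monoʳ-≤ 2 α≤N) (≤-reflexive (cong (N +_) (+-identityʳ N)))))

-- From X = (R ∧ 𝕗) to 𝕗, coweakening R.  Both non-trivial cases of Υ have this shape.
collapse : Fm → Fm → Deriv
collapse X R = step1 X (R ∧ 𝕗) ⊙ (cowk R ∧ᴰ triv 𝕗) ⊙ step1 (𝕥 ∧ 𝕗) 𝕗

collapse-exact : ∀ {X R} → X ≈ (R ∧ 𝕗) → FalseFree R → Exactly (collapse X R) X 𝕗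
collapse-exact X≈R∧𝕗 ffR =
  ⊙-exact (⊙-exact (step-exact eq X≈R∧𝕗) (parallel-exact ∧-connective (cowk-exact ffR) (trivial-exact 𝕗)))
          (step-exact eq 𝕥∧-unit)

collapse-cost : ∀ X {R} → FalseFree R → Cost (fsize X + 2 * fsize R + 1) (collapse X R)
collapse-cost X {R} ffR = cost (width-mono (collapse X R) width≤ widths) steps≤
  where
  x r : ℕ
  x = fsize X
  r = fsize R
  width≤ : x + (r + 1) ≤ x + 2 * r + 1
  width≤ = ≤-trans (≤-reflexive (sym (+-assoc x r 1))) (+-monoˡ-≤ 1 (+-monoʳ-≤ x (m≤m+n r _)))
  2≤x+[r+1] : 2 ≤ x + (r + 1)
  2≤x+[r+1] = +-mono-≤ (fsize≥1 X) (m≤n+m 1 r)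
  r+1≤x+[r+1] : r + 1 ≤ x + (r + 1)
  r+1≤x+[r+1] = m≤n+m (r + 1) x
  widths : Width (x + (r + 1)) (collapse X R)
  widths = width-⊙ (step1 X (R ∧ 𝕗) ⊙ (cowk R ∧ᴰ triv 𝕗)) (step1 (𝕥 ∧ 𝕗) 𝕗)
            (width-⊙ (step1 X (R ∧ 𝕗)) (cowk R ∧ᴰ triv 𝕗) (m≤m+n x (r + 1) ∷ r+1≤x+[r+1] ∷ [])
              (width-mono (cowk R ∧ᴰ triv 𝕗) r+1≤x+[r+1]
                (width-parallel ∧-connective (cowk R) (triv 𝕗) (cowk-width ffR) (≤-refl ∷ []))))
            (2≤x+[r+1] ∷ ≤-trans (s≤s z≤n) 2≤x+[r+1] ∷ [])
  steps≤ : steps (collapse X R) ≤ x + 2 * r + 1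
  steps≤ = begin
    steps (collapse X R)           ≡⟨ steps-⊙ (step1 X (R ∧ 𝕗) ⊙ (cowk R ∧ᴰ triv 𝕗)) (step1 (𝕥 ∧ 𝕗) 𝕗) ⟩
    suc (steps (cowk R ∧ᴰ triv 𝕗)) + 1 ≡⟨ cong (λ s → suc s + 1) (trans (steps-parallel _∧_ (cowk R) (triv 𝕗)) (+-identityʳ _)) ⟩
    suc (steps (cowk R)) + 1       ≤⟨ +-monoˡ-≤ 1 (cowk-steps ffR) ⟩
    2 * r + 1                      ≤⟨ +-monoˡ-≤ 1 (m≤n+m (2 * r) x) ⟩
    x + 2 * r + 1                  ∎
    where open ≤-Reasoning

T⇒true : ∀ {b} → T b → b ≡ true
T⇒true {true} _ = refl

¬T⇒false : ∀ {b} → ¬ T b → b ≡ false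
¬T⇒false {false} _ = refl
¬T⇒false {true} ¬t = ⊥-elim (¬t tt)

≤ᵇ-true : ∀ {m n} → m ≤ n → (m ≤ᵇ n) ≡ true
≤ᵇ-true h = T⇒true (≤⇒≤ᵇ h)

≤ᵇ-false : ∀ {m n} → n < m → (m ≤ᵇ n) ≡ false
≤ᵇ-false {m} {n} h = ¬T⇒false (λ t → <⇒≱ h (≤ᵇ⇒≤ m n t))

<ᵇ-true : ∀ {m n} → m < n → (m <ᵇ n) ≡ true
<ᵇ-true h = T⇒true (<⇒<ᵇ h)

<ᵇ-false : ∀ {m n} → n ≤ m → (m <ᵇ n) ≡ false
<ᵇ-false {m} {n} h = ¬T⇒false (λ t → ≤⇒≯ h (<ᵇ⇒< m n t))

≡ᵇ-true : ∀ m → (m ≡ᵇ m) ≡ true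
≡ᵇ-true m = T⇒true (≡⇒≡ᵇ m m refl)

≡ᵇ-false : ∀ {m n} → m ≢ n → (m ≡ᵇ n) ≡ false
≡ᵇ-false {m} {n} m≢n = ¬T⇒false (λ t → m≢n (≡ᵇ⇒≡ m n t))

≤ᵇ-sound : ∀ {m n} → (m ≤ᵇ n) ≡ true → m ≤ n
≤ᵇ-sound {m} {n} e = ≤ᵇ⇒≤ m n (subst T (sym e) tt)

≤ᵇ-suc : ∀ m n → (suc m ≤ᵇ suc n) ≡ (m ≤ᵇ n)
≤ᵇ-suc zero n = refl
≤ᵇ-suc (suc m) n = refl

-- m - (m - n) = min(m, n) ≤ n.
m∸[m∸n]≤n : ∀ m n → m ∸ (m ∸ n) ≤ n
m∸[m∸n]≤n m n with ≤-total n m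
... | inj₁ n≤m = ≤-reflexive (m∸[m∸n]≡n n≤m)
... | inj₂ m≤n rewrite m≤n⇒m∸n≡0 m≤n = m≤n

[_⇒_] : Bool → Fm → Fm
[ b ⇒ φ ] = if b then φ else 𝕗

[⇒]-cong-when : ∀ b {φ ψ} → (T b → φ ≈ ψ) → [ b ⇒ φ ] ≈ [ b ⇒ ψ ]
[⇒]-cong-when true e = e tt
[⇒]-cong-when false _ = ≈-refl

⋁-filter : ∀ (T : ℕ → Fm) P is → ⋁ (map T (filterᵇ P is)) ≈ ⋁ (map (λ i → [ P i ⇒ T i ]) is)
⋁-filter T P [] = ≈-refl
⋁-filter T P (i ∷ is) with P i
... | true = ⋁-cons (T i) (map T (filterᵇ P is)) ⟨≈⟩ ∨-cong ≈-refl (⋁-filter T P is) ⟨≈⟩ ≈-sym (⋁-cons (T i) guarded)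
  where
  guarded : List Fm
  guarded = map (λ i → [ P i ⇒ T i ]) is
... | false = ⋁-filter T P is ⟨≈⟩ ≈-sym 𝕗∨-unit ⟨≈⟩ ≈-sym (⋁-cons 𝕗 (map (λ i → [ P i ⇒ T i ]) is))

⋁< : ℕ → (ℕ → Fm) → Fm
⋁< m T = ⋁ (map T (upTo m))

⋁<-suc : ∀ m T → ⋁< (suc m) T ≈ (⋁< m T ∨ T m)
⋁<-suc m T = ≡⇒≈ (cong (λ is → ⋁ (map T is)) (sym (upTo-∷ʳ m))) ⟨≈⟩
             ≡⇒≈ (cong ⋁ (map-++ T (upTo m) (m ∷ []))) ⟨≈⟩ ⋁-++ (map T (upTo m)) (T m ∷ [])

⋁<-shift : ∀ m T → ⋁< (suc m) T ≈ (T 0 ∨ ⋁< m (T ∘ suc))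
⋁<-shift m T = ⋁-cons (T 0) (map T (applyUpTo suc m)) ⟨≈⟩
  ∨-cong ≈-refl (≡⇒≈ (cong ⋁ (trans (map-applyUpTo suc T m) (sym (map-upTo (T ∘ suc) m)))))

⋁<-cong : ∀ m {T U} → (∀ i → i < m → T i ≈ U i) → ⋁< m T ≈ ⋁< m U
⋁<-cong zero h = ≈-refl
⋁<-cong (suc m) {T} {U} h = ⋁<-suc m T ⟨≈⟩ ∨-cong (⋁<-cong m (λ i i<m → h i (m<n⇒m<1+n i<m))) (h m ≤-refl)
                           ⟨≈⟩ ≈-sym (⋁<-suc m U)

⋁<-split : ∀ m {T U V} → (∀ i → i < m → T i ≈ (U i ∨ V i)) → ⋁< m T ≈ (⋁< m U ∨ ⋁< m V)
⋁<-split zero h = ≈-sym ∨-unit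
⋁<-split (suc m) {T} {U} {V} h =
  ⋁<-suc m T ⟨≈⟩ ∨-cong (⋁<-split m (λ i i<m → h i (m<n⇒m<1+n i<m))) (h m ≤-refl)
  ⟨≈⟩ ∨-interchange ⟨≈⟩ ≈-sym (∨-cong (⋁<-suc m U) (⋁<-suc m V))

⋁<-none : ∀ m {T} → (∀ i → i < m → T i ≈ 𝕗) → ⋁< m T ≈ 𝕗
⋁<-none zero h = ≈-refl
⋁<-none (suc m) {T} h = ⋁<-suc m T ⟨≈⟩ ∨-cong (⋁<-none m (λ i i<m → h i (m<n⇒m<1+n i<m))) (h m ≤-refl) ⟨≈⟩ ∨-unit

⋁<-single : ∀ m {T} c → c < m → (∀ i → i < m → i ≢ c → T i ≈ 𝕗) → ⋁< m T ≈ T c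
⋁<-single (suc m) {T} c c<1+m h with m ≟ c
... | yes refl = ⋁<-suc m T ⟨≈⟩ ∨-cong (⋁<-none m (λ i i<m → h i (m<n⇒m<1+n i<m) (<⇒≢ i<m))) ≈-refl ⟨≈⟩ 𝕗∨-unit
... | no m≢c = ⋁<-suc m T ⟨≈⟩
  ∨-cong (⋁<-single m c (≤∧≢⇒< (≤-pred c<1+m) (m≢c ∘ sym)) (λ i i<m → h i (m<n⇒m<1+n i<m))) (h m ≤-refl m≢c)
  ⟨≈⟩ ∨-unit

⋁<-at : ∀ m c (T : ℕ → Fm) → ⋁< m (λ i → [ i ≡ᵇ c ⇒ T i ]) ≈ [ c <ᵇ m ⇒ T c ]
⋁<-at m c T with c <? m
... | yes c<m rewrite <ᵇ-true c<m =
  ⋁<-single m c c<m (λ i _ i≢c → ≡⇒≈ (cong [_⇒ T i ] (≡ᵇ-false i≢c))) ⟨≈⟩ ≡⇒≈ (cong [_⇒ T c ] (≡ᵇ-true c))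
... | no c≮m rewrite <ᵇ-false (≮⇒≥ c≮m) =
  ⋁<-none m (λ i i<m → ≡⇒≈ (cong [_⇒ T i ] (≡ᵇ-false (λ i≡c → c≮m (subst (_< m) i≡c i<m)))))

⋁-closed : (P : Fm → Set) → (∀ {α β} → P α → P β → P (α ∨ β)) → ∀ φs → φs ≢ [] → All P φs → P (⋁ φs)
⋁-closed P _ [] []≢[] _ = ⊥-elim ([]≢[] refl)
⋁-closed P _ (φ ∷ []) _ (h ∷ []) = h
⋁-closed P ∨-closed (φ ∷ ψ ∷ φs) _ (h ∷ hs) = ∨-closed h (⋁-closed P ∨-closed (ψ ∷ φs) (λ ()) hs)

map-nonempty : ∀ {A : Set} (f : A → Fm) xs → xs ≢ [] → map f xs ≢ []
map-nonempty f [] []≢[] = ⊥-elim ([]≢[] refl)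
map-nonempty f (x ∷ xs) _ ()

-- The index range of θ and Γ: the splittings i + j = k with j ≤ q.

window : ℕ → ℕ → ℕ → Bool
window q k i = (i ≤ᵇ k) && ((k ∸ i) ≤ᵇ q)

window-true : ∀ {q k i} → i ≤ k → k ∸ i ≤ q → window q k i ≡ true
window-true i≤k k-i≤q rewrite ≤ᵇ-true i≤k | ≤ᵇ-true k-i≤q = refl

window-false : ∀ {q k i} → q + i < k → window q k i ≡ false
window-false {q} {k} {i} q+i<k rewrite ≤ᵇ-false (m+n≤o⇒m≤o∸n (suc q) q+i<k) = ∧-zeroʳ (i ≤ᵇ k)

window-sound : ∀ {q k i} → T (window q k i) → i ≤ k × k ∸ i ≤ q
window-sound {q} {k} {i} t with Equivalence.to T-∧ t
... | t₁ , t₂ = ≤ᵇ⇒≤ i k t₁ , ≤ᵇ⇒≤ (k ∸ i) q t₂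

-- If q + i < k then the split would need j > q, so the summand i vanishes.
closed-window : ∀ q k i φ → q + i < k → [ window q k i ⇒ φ ] ≈ 𝕗
closed-window q k i φ q+i<k = ≡⇒≈ (cong [_⇒ φ ] (window-false {q} {k} {i} q+i<k))

window-suc : ∀ q k i → window q (suc k) (suc i) ≡ window q k i
window-suc q k i = cong (_&& ((k ∸ i) ≤ᵇ q)) (≤ᵇ-suc i k)

-- Lowering the bound q of the window by one loses exactly the splitting j = q, i.e. i = k - q.
window-lower : ∀ q k i φ → 1 ≤ q →
  [ window q k i ⇒ φ ] ≈ ([ window (q ∸ 1) k i ⇒ φ ] ∨ [ i ≡ᵇ k ∸ q ⇒ [ q ≤ᵇ k ⇒ φ ] ])
window-lower (suc q) k i φ _ with i ≤? k
-- i > k: no guard holds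
... | no i≰k rewrite ≤ᵇ-false (≰⇒> i≰k) | ≡ᵇ-false {i} {k ∸ suc q} (λ i≡k-q → i≰k (subst (_≤ k) (sym i≡k-q) (m∸n≤m k (suc q)))) =
  ≈-sym ∨-unit
... | yes i≤k rewrite ≤ᵇ-true i≤k with <-cmp (k ∸ i) (suc q)
-- j = k - i < q: the lowered window holds, and i = k - q would force j = q
...   | tri< j<1+q _ _ rewrite ≤ᵇ-true (<⇒≤ j<1+q) | ≤ᵇ-true (≤-pred j<1+q) = ≈-sym ∨-unit ⟨≈⟩ ∨-cong ≈-refl (≈-sym none)
  where
  none : [ i ≡ᵇ k ∸ suc q ⇒ [ suc q ≤ᵇ k ⇒ φ ] ] ≈ 𝕗
  none with i ≟ k ∸ suc q | suc q ≤? k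
  ... | no i≢k-q | _ rewrite ≡ᵇ-false i≢k-q = ≈-refl
  ... | yes refl | yes q≤k = ⊥-elim (<-irrefl (m∸[m∸n]≡n q≤k) j<1+q)
  ... | yes refl | no q≰k rewrite ≡ᵇ-true (k ∸ suc q) | ≤ᵇ-false (≰⇒> q≰k) = ≈-refl
-- j = q: only the new guard holds
...   | tri≈ _ j≡1+q _ rewrite ≤ᵇ-true (≤-reflexive j≡1+q) | ≤ᵇ-false {k ∸ i} {q} (≤-reflexive (sym j≡1+q))
        | ≤ᵇ-true (subst (_≤ k) j≡1+q (m∸n≤m k i))
        | sym (trans (cong (k ∸_) (sym j≡1+q)) (m∸[m∸n]≡n i≤k)) | ≡ᵇ-true (k ∸ suc q) = ≈-sym 𝕗∨-unit
-- j > q: no guard holds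
...   | tri> _ _ j>1+q rewrite ≤ᵇ-false j>1+q | ≤ᵇ-false {k ∸ i} {q} (<-trans (n<1+n q) j>1+q)
        | ≡ᵇ-false {i} {k ∸ suc q} (λ i≡k-q → <⇒≱ j>1+q (subst (λ i → k ∸ i ≤ suc q) (sym i≡k-q) (m∸[m∸n]≤n k (suc q)))) =
  ≈-sym ∨-unit

-- Raising k by one while lowering q by one loses exactly the splitting i = k + 1.
window-raise : ∀ q k i φ → 1 ≤ q →
  [ window q (suc k) i ⇒ φ ] ≈ ([ window (q ∸ 1) k i ⇒ φ ] ∨ [ i ≡ᵇ suc k ⇒ φ ])
window-raise (suc q) k i φ _ with i ≤? k
-- i ≤ k: both windows agree, and i ≠ k + 1
... | yes i≤k rewrite ≤ᵇ-true (m≤n⇒m≤1+n i≤k) | ≤ᵇ-true i≤k | +-∸-assoc 1 i≤k | ≤ᵇ-suc (k ∸ i) q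
        | ≡ᵇ-false {i} {suc k} (<⇒≢ (s≤s i≤k)) = ≈-sym ∨-unit
... | no i≰k with i ≟ suc k
-- i = k + 1: only the new guard holds
...   | yes refl rewrite <ᵇ-true (n<1+n k) | n∸n≡0 k | ≤ᵇ-false (n<1+n k) | ≡ᵇ-true k = ≈-sym 𝕗∨-unit
-- i > k + 1: no guard holds
...   | no i≢1+k rewrite ≤ᵇ-false {i} {suc k} (≤∧≢⇒< (≰⇒> i≰k) (i≢1+k ∘ sym)) | ≤ᵇ-false (≰⇒> i≰k) | ≡ᵇ-false i≢1+k =
  ≈-sym ∨-unit

⋁-idx : ∀ (T : ℕ → Fm) m q k → ⋁ (map T (idx m q k)) ≈ ⋁< m (λ i → [ window q k i ⇒ T i ])
⋁-idx T m q k = ⋁-filter T (window q k) (upTo m)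

idx-bounds : ∀ m q k → All (λ i → i < m × i ≤ k × k ∸ i ≤ q) (idx m q k)
idx-bounds m q k =
  All.zipWith (λ (i<m , t) → i<m , window-sound t) (filter⁺ (T? ∘ window q k) (all-upTo m) , all-filter (T? ∘ window q k) (upTo m))

idx-length : ∀ m q k → length (idx m q k) ≤ m
idx-length m q k = ≤-trans (length-filter (T? ∘ window q k) (upTo m)) (≤-reflexive (length-upTo m))

idx-nonempty : ∀ {m q k} i → i < m → i ≤ k → k ∸ i ≤ q → idx m q k ≢ []
idx-nonempty {m} {q} {k} i i<m i≤k k-i≤q idx≡[] with subst (i ∈_) idx≡[] i∈idx
  where
  i∈idx : i ∈ idx m q k
  i∈idx = ∈-filter⁺ (T? ∘ window q k) (∈-upTo⁺ i<m) (Equivalence.from T-∧ (≤⇒≤ᵇ i≤k , ≤⇒≤ᵇ k-i≤q))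
... | ()

sub-miss : ∀ {c b} β → c ≢ b → at b [ c ≔ β ] ≡ at b
sub-miss {c} {b} β c≢b with c ≟L b
... | yes c≡b = ⊥-elim (c≢b c≡b)
... | no _ = refl

sub-hit : ∀ c β → at c [ c ≔ β ] ≡ β
sub-hit c β with c ≟L c
... | yes _ = refl
... | no c≢c = ⊥-elim (c≢c refl)

⋁-sub : ∀ φs c β → ⋁ φs [ c ≔ β ] ≡ ⋁ (map (_[ c ≔ β ]) φs)
⋁-sub [] c β = refl
⋁-sub (φ ∷ []) c β = refl
⋁-sub (φ ∷ ψ ∷ φs) c β = cong (φ [ c ≔ β ] ∨_) (⋁-sub (ψ ∷ φs) c β)

⋀-sub : ∀ φs c β → ⋀ φs [ c ≔ β ] ≡ ⋀ (map (_[ c ≔ β ]) φs)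
⋀-sub [] c β = refl
⋀-sub (φ ∷ []) c β = refl
⋀-sub (φ ∷ ψ ∷ φs) c β = cong (φ [ c ≔ β ] ∧_) (⋀-sub (ψ ∷ φs) c β)

sub-≈ : ∀ {α β} c γ → α ≈ β → (α [ c ≔ γ ]) ≈ (β [ c ≔ γ ])
sub-≈ c γ ≈-refl = ≈-refl
sub-≈ c γ (≈-sym e) = ≈-sym (sub-≈ c γ e)
sub-≈ c γ (≈-trans e e') = ≈-trans (sub-≈ c γ e) (sub-≈ c γ e')
sub-≈ c γ (∨-cong e e') = ∨-cong (sub-≈ c γ e) (sub-≈ c γ e')
sub-≈ c γ (∧-cong e e') = ∧-cong (sub-≈ c γ e) (sub-≈ c γ e')
sub-≈ c γ ∨-assoc = ∨-assoc
sub-≈ c γ ∧-assoc = ∧-assoc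
sub-≈ c γ ∨-comm = ∨-comm
sub-≈ c γ ∧-comm = ∧-comm
sub-≈ c γ ∨-unit = ∨-unit
sub-≈ c γ ∧-unit = ∧-unit
sub-≈ c γ tt-eq = tt-eq
sub-≈ c γ ff-eq = ff-eq

fsize-sub : ∀ α c β → fsize β ≡ 1 → fsize (α [ c ≔ β ]) ≡ fsize α
fsize-sub 𝕥 c β _ = refl
fsize-sub 𝕗 c β _ = refl
fsize-sub (at b) c β h with c ≟L b
... | yes _ = h
... | no _ = refl
fsize-sub (α ∨ α') c β h = cong₂ _+_ (fsize-sub α c β h) (fsize-sub α' c β h)
fsize-sub (α ∧ α') c β h = cong₂ _+_ (fsize-sub α c β h) (fsize-sub α' c β h)

⋁<-sub : ∀ m (T : ℕ → Fm) c β → ⋁< m T [ c ≔ β ] ≡ ⋁< m (λ i → T i [ c ≔ β ])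
⋁<-sub m T c β = trans (⋁-sub (map T (upTo m)) c β) (cong ⋁ (sym (map-∘ (upTo m))))

[⇒]-sub : ∀ b φ c β → [ b ⇒ φ ] [ c ≔ β ] ≡ [ b ⇒ φ [ c ≔ β ] ]
[⇒]-sub true φ c β = refl
[⇒]-sub false φ c β = refl

Distinct : List Lit → Set
Distinct = AllPairs (λ a b → var a ≢ var b)

Fresh : Lit → List Lit → Set
Fresh c as = All (λ b → var c ≢ var b) as

nth∈ : ∀ as l → 1 ≤ l → l ≤ length as → nth as l ∈ as
nth∈ (a ∷ as) 1 _ _ = here refl
nth∈ (a ∷ as) (suc (suc l)) _ (s≤s l≤n) = there (nth∈ as (suc l) (s≤s z≤n) l≤n)

fresh-right : ∀ xs ys {c} → Distinct (xs ++ ys) → c ∈ xs → Fresh c ys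
fresh-right (x ∷ xs) ys (h ∷ _) (here refl) = ++⁻ʳ xs h
fresh-right (x ∷ xs) ys (_ ∷ d) (there c∈xs) = fresh-right xs ys d c∈xs

fresh-left : ∀ xs ys {c} → Distinct (xs ++ ys) → c ∈ ys → Fresh c xs
fresh-left [] ys d c∈ys = []
fresh-left (x ∷ xs) ys (h ∷ d) c∈ys = (λ e → All.lookup (++⁻ʳ xs h) c∈ys (sym e)) ∷ fresh-left xs ys d c∈ys

nth-take : ∀ as p l → 1 ≤ l → l ≤ p → nth (take p as) l ≡ nth as l
nth-take as zero (suc l) _ ()
nth-take [] (suc p) l _ _ = refl
nth-take (a ∷ as) (suc p) 1 _ _ = refl
nth-take (a ∷ as) (suc p) (suc (suc l)) _ (s≤s l≤p) = nth-take as p (suc l) (s≤s z≤n) l≤p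

nth-drop : ∀ as p l → p < l → nth (drop p as) (l ∸ p) ≡ nth as l
nth-drop as zero l _ = refl
nth-drop [] (suc p) (suc l) _ = nth[] (l ∸ p)
  where
  nth[] : ∀ m → nth [] m ≡ pos 0
  nth[] zero = refl
  nth[] (suc m) = refl
nth-drop (a ∷ as) (suc p) (suc (suc l)) (s≤s p<1+l) = nth-drop as p (suc l) p<1+l

⋀-falseFree : ∀ φs → All FalseFree φs → FalseFree (⋀ φs)
⋀-falseFree [] [] = ff-𝕥
⋀-falseFree (φ ∷ []) (h ∷ []) = h
⋀-falseFree (φ ∷ ψ ∷ φs) (h ∷ hs) = ff-∧ h (⋀-falseFree (ψ ∷ φs) hs)

atoms-falseFree : ∀ as → All FalseFree (map at as)
atoms-falseFree [] = []
atoms-falseFree (a ∷ as) = ff-at a ∷ atoms-falseFree as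

-- The size of a conjunction: the sum of the sizes, plus one for the empty conjunction 𝕥.
fsize-⋀ : ∀ φs → fsize (⋀ φs) ≤ 1 + sum (map fsize φs)
fsize-⋀ [] = ≤-refl
fsize-⋀ (φ ∷ []) = ≤-trans (≤-reflexive (sym (+-identityʳ _))) (n≤1+n _)
fsize-⋀ (φ ∷ ψ ∷ φs) = ≤-trans (+-monoʳ-≤ (fsize φ) (fsize-⋀ (ψ ∷ φs))) (≤-reflexive (+-suc (fsize φ) _))

sum-atoms : ∀ as → sum (map fsize (map at as)) ≡ length as
sum-atoms [] = refl
sum-atoms (a ∷ as) = cong suc (sum-atoms as)

fsize-atoms∧ : ∀ as φ → fsize (⋀ (map at as ++ (φ ∷ []))) ≤ 1 + (length as + fsize φ)
fsize-atoms∧ as φ = ≤-trans (fsize-⋀ (map at as ++ (φ ∷ []))) (+-monoʳ-≤ 1 (≤-reflexive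
  (trans (cong sum (map-++ fsize (map at as) (φ ∷ [])))
         (trans (sum-++ (map fsize (map at as)) (fsize φ ∷ [])) (cong₂ _+_ (sum-atoms as) (+-identityʳ (fsize φ)))))))

fsize-∧atoms : ∀ φ as → fsize (⋀ (φ ∷ map at as)) ≤ 1 + (fsize φ + length as)
fsize-∧atoms φ as = ≤-trans (fsize-⋀ (φ ∷ map at as)) (≤-reflexive (cong (λ s → 1 + (fsize φ + s)) (sum-atoms as)))

⋀-atoms-fresh : ∀ as {c} β → Fresh c as → ⋀ (map at as) [ c ≔ β ] ≡ ⋀ (map at as)
⋀-atoms-fresh as {c} β fresh = trans (⋀-sub (map at as) c β) (cong ⋀ (trans (sym (map-∘ as)) (go as fresh)))
  where
  go : ∀ as → Fresh c as → map (λ a → at a [ c ≔ β ]) as ≡ map at as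
  go [] _ = refl
  go (a ∷ as) (c≢a ∷ fresh) = cong₂ _∷_ (sub-miss β (λ c≡a → c≢a (cong var c≡a))) (go as fresh)

⋀-remove : ∀ as l → Distinct as → 1 ≤ l → l ≤ length as →
           ⋀ (map at as) [ nth as l ≔ 𝕗 ] ≈ (⋀ (map at (removeNth l as)) ∧ 𝕗)
⋀-remove (a ∷ as) 1 (a-fresh ∷ _) _ _ =
  sub-≈ a 𝕗 (⋀-cons (at a) (map at as)) ⟨≈⟩
  ∧-cong (≡⇒≈ (sub-hit a 𝕗)) (≡⇒≈ (⋀-atoms-fresh as 𝕗 a-fresh)) ⟨≈⟩ ∧-comm
⋀-remove (a ∷ as) (suc (suc l)) (a-fresh ∷ d) _ (s≤s l≤n) =
  sub-≈ c 𝕗 (⋀-cons (at a) (map at as)) ⟨≈⟩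
  ∧-cong (≡⇒≈ (sub-miss 𝕗 c≢a)) (⋀-remove as (suc l) d (s≤s z≤n) l≤n) ⟨≈⟩ ≈-sym ∧-assoc ⟨≈⟩
  ∧-cong (≈-sym (⋀-cons (at a) (map at (removeNth (suc l) as)))) ≈-refl
  where
  c : Lit
  c = nth as (suc l)
  c≢a : c ≢ a
  c≢a c≡a = All.lookup a-fresh (nth∈ as (suc l) (s≤s z≤n) l≤n) (cong var (sym c≡a))

length-removeNth : ∀ l as → length (removeNth l as) ≤ length as
length-removeNth _ [] = z≤n
length-removeNth zero (a ∷ as) = ≤-refl
length-removeNth 1 (a ∷ as) = n≤1+n _
length-removeNth (suc (suc l)) (a ∷ as) = s≤s (length-removeNth (suc l) as)

pOf : List Lit → ℕ
pOf as = ⌊ length as /2⌋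

qOf : List Lit → ℕ
qOf as = length as ∸ pOf as

leftHalf : List Lit → List Lit
leftHalf as = take (pOf as) as

rightHalf : List Lit → List Lit
rightHalf as = drop (pOf as) as

length-leftHalf : ∀ as → length (leftHalf as) ≡ pOf as
length-leftHalf as = trans (length-take (pOf as) as) (m≤n⇒m⊓n≡m (⌊n/2⌋≤n (length as)))

length-rightHalf : ∀ as → length (rightHalf as) ≡ qOf as
length-rightHalf as = length-drop (pOf as) as

p+q≡n : ∀ as → pOf as + qOf as ≡ length as
p+q≡n as = m+[n∸m]≡n (⌊n/2⌋≤n (length as))

q≡⌈n/2⌉ : ∀ as → qOf as ≡ ⌈ length as /2⌉
q≡⌈n/2⌉ as = trans (cong (_∸ pOf as) (sym (⌊n/2⌋+⌈n/2⌉≡n (length as)))) (m+n∸m≡n (pOf as) _)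

p<n : ∀ a b r → pOf (a ∷ b ∷ r) < length (a ∷ b ∷ r)
p<n a b r = ⌊n/2⌋<n (suc (length r))

1≤q : ∀ a b r → 1 ≤ qOf (a ∷ b ∷ r)
1≤q a b r = m<n⇒0<n∸m (p<n a b r)

q<n : ∀ a b r → qOf (a ∷ b ∷ r) < length (a ∷ b ∷ r)
q<n a b r = s≤s (m∸n≤m (suc (length r)) ⌊ length r /2⌋)

leftHalf-shorter : ∀ a b r → length (leftHalf (a ∷ b ∷ r)) < length (a ∷ b ∷ r)
leftHalf-shorter a b r = subst (_< length (a ∷ b ∷ r)) (sym (length-leftHalf (a ∷ b ∷ r))) (p<n a b r)

rightHalf-shorter : ∀ a b r → length (rightHalf (a ∷ b ∷ r)) < length (a ∷ b ∷ r)
rightHalf-shorter a b r = subst (_< length (a ∷ b ∷ r)) (sym (length-rightHalf (a ∷ b ∷ r))) (q<n a b r)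

leftHalf-nonempty : ∀ a b r → 1 ≤ length (leftHalf (a ∷ b ∷ r))
leftHalf-nonempty a b r = subst (1 ≤_) (sym (length-leftHalf (a ∷ b ∷ r))) (s≤s z≤n)

rightHalf-nonempty : ∀ a b r → 1 ≤ length (rightHalf (a ∷ b ∷ r))
rightHalf-nonempty a b r = subst (1 ≤_) (sym (length-rightHalf (a ∷ b ∷ r))) (1≤q a b r)

distinct-halves : ∀ as → Distinct as → Distinct (leftHalf as ++ rightHalf as)
distinct-halves as d = subst Distinct (sym (take++drop≡id (pOf as) as)) d

halving-induction : (P : List Lit → Set) → (∀ a → P (a ∷ [])) →
  (∀ a b r → P (leftHalf (a ∷ b ∷ r)) → P (rightHalf (a ∷ b ∷ r)) → P (a ∷ b ∷ r)) →
  ∀ as → 1 ≤ length as → P as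
halving-induction P base step as 1≤n = go (length as) as ≤-refl 1≤n
  where
  go : ∀ f as → length as ≤ f → 1 ≤ length as → P as
  go f (a ∷ []) _ _ = base a
  go (suc f) (a ∷ b ∷ r) (s≤s n≤1+f) _ =
    step a b r (go f _ (≤-pred (≤-trans (leftHalf-shorter a b r) (s≤s n≤1+f))) (leftHalf-nonempty a b r))
               (go f _ (≤-pred (≤-trans (rightHalf-shorter a b r) (s≤s n≤1+f))) (rightHalf-nonempty a b r))

-- Threshold formulae.

θf-fuel : ∀ as → 1 ≤ length as → ∀ f g k → length as ≤ f → length as ≤ g → θf f as k ≡ θf g as k
θf-fuel = halving-induction P base step
  where
  P : List Lit → Set
  P as = ∀ f g k → length as ≤ f → length as ≤ g → θf f as k ≡ θf g as k
  base : ∀ a → P (a ∷ [])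
  base a f g zero _ _ = refl
  base a f g 1 _ _ = refl
  base a f g (suc (suc k)) _ _ = refl
  step : ∀ a b r → P (leftHalf (a ∷ b ∷ r)) → P (rightHalf (a ∷ b ∷ r)) → P (a ∷ b ∷ r)
  step a b r IHl IHr f g zero _ _ = refl
  step a b r IHl IHr (suc f) (suc g) (suc k) n≤1+f n≤1+g =
    cong (λ φs → if length as <ᵇ suc k then 𝕗 else ⋁ φs)
      (map-cong (λ i → cong₂ _∧_ (IHl f g i (shorter (leftHalf-shorter a b r) n≤1+f) (shorter (leftHalf-shorter a b r) n≤1+g))
                                  (IHr f g (suc k ∸ i) (shorter (rightHalf-shorter a b r) n≤1+f) (shorter (rightHalf-shorter a b r) n≤1+g)))
                (idx (suc (pOf as)) (qOf as) (suc k)))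
    where
    as : List Lit
    as = a ∷ b ∷ r
    shorter : ∀ {m h} → m < length as → length as ≤ suc h → m ≤ h
    shorter m<n n≤1+h = ≤-pred (≤-trans m<n n≤1+h)

θ-beyond : ∀ as k → length as < k → θ as k ≡ 𝕗
θ-beyond [] (suc k) _ = refl
θ-beyond (a ∷ []) 1 (s≤s ())
θ-beyond (a ∷ []) (suc (suc k)) _ = refl
θ-beyond (a ∷ b ∷ r) (suc k) n<k rewrite <ᵇ-true n<k = refl

module Halves (a b : Lit) (r : List Lit) where

  as : List Lit
  as = a ∷ b ∷ r

  n p q : ℕ
  n = length as
  p = pOf as
  q = qOf as

  xs ys : List Lit
  xs = leftHalf as
  ys = rightHalf as

  length-xs : length xs ≡ p
  length-xs = length-leftHalf as

  length-ys : length ys ≡ q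
  length-ys = length-rightHalf as

  k-p≤q : ∀ {k} → k ≤ n → k ∸ p ≤ q
  k-p≤q {k} k≤n = m≤n+o⇒m∸n≤o k p (subst (k ≤_) (sym (p+q≡n as)) k≤n)

  k-q≤p : ∀ {k} → k ≤ n → k ∸ q ≤ p
  k-q≤p {k} k≤n = m≤n+o⇒m∸n≤o k q (subst (k ≤_) (trans (sym (p+q≡n as)) (+-comm p q)) k≤n)

  θ-unfold : ∀ k → 1 ≤ k → k ≤ n → θ as k ≡ ⋁ (map (λ i → θ xs i ∧ θ ys (k ∸ i)) (idx (suc p) q k))
  θ-unfold (suc k) _ k≤n rewrite <ᵇ-false {n} {suc k} k≤n =
    cong ⋁ (map-cong (λ i → cong₂ _∧_ (fuel xs i (leftHalf-nonempty a b r) (leftHalf-shorter a b r))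
                                       (fuel ys (suc k ∸ i) (rightHalf-nonempty a b r) (rightHalf-shorter a b r)))
                     (idx (suc p) q (suc k)))
    where
    fuel : ∀ zs j → 1 ≤ length zs → length zs < n → θf (suc (length r)) zs j ≡ θ zs j
    fuel zs j 1≤m m<n = θf-fuel zs 1≤m (suc (length r)) (length zs) j (≤-pred m<n) ≤-refl

  -- For k ≤ n the splitting i = k - q is in range, so θ^n_k is a non-empty disjunction.
  idx-nonempty-θ : ∀ k → k ≤ n → idx (suc p) q k ≢ []
  idx-nonempty-θ k k≤n = idx-nonempty (k ∸ q) (s≤s (k-q≤p k≤n)) (m∸n≤m k q) (m∸[m∸n]≤n k q)

  -- θ^n_k as the guarded disjunction of the p + 1 possible splittings of k,
  -- valid for all k ≤ n + 1 (the cases k = 0 and k = n + 1 included).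
  θ-split : ∀ k → k ≤ suc n → θ as k ≈ ⋁< (suc p) (λ i → [ window q k i ⇒ θ xs i ∧ θ ys (k ∸ i) ])
  θ-split zero _ = ≈-sym (⋁<-single (suc p) 0 (s≤s z≤n) others ⟨≈⟩ ∧-unit)
    where
    others : ∀ i → i < suc p → i ≢ 0 → [ window q 0 i ⇒ θ xs i ∧ θ ys (0 ∸ i) ] ≈ 𝕗
    others zero _ 0≢0 = ⊥-elim (0≢0 refl)
    others (suc i) _ _ = ≈-refl
  θ-split (suc k) _ with suc k ≤? n
  ... | yes k≤n = ≡⇒≈ (θ-unfold (suc k) (s≤s z≤n) k≤n) ⟨≈⟩ ⋁-idx (λ i → θ xs i ∧ θ ys (suc k ∸ i)) (suc p) q (suc k)
  ... | no k≰n rewrite θ-beyond as (suc k) (≰⇒> k≰n) = ≈-sym (⋁<-none (suc p) none)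
    where
    -- k + 1 > n = p + q atoms cannot be split with i ≤ p and j ≤ q
    none : ∀ i → i < suc p → [ window q (suc k) i ⇒ θ xs i ∧ θ ys (suc k ∸ i) ] ≈ 𝕗
    none i (s≤s i≤p) = closed-window q (suc k) i _ (begin-strict
      q + i   ≤⟨ +-monoʳ-≤ q i≤p ⟩
      q + p   ≡⟨ +-comm q p ⟩
      p + q   ≡⟨ p+q≡n as ⟩
      n       <⟨ ≰⇒> k≰n ⟩
      suc k   ∎)
      where open ≤-Reasoning

  summand : Lit → Fm → ℕ → ℕ → Fm
  summand c β k i = (θ xs i [ c ≔ β ]) ∧ (θ ys (k ∸ i) [ c ≔ β ])

  θ-split-sub : ∀ k c β → k ≤ suc n → (θ as k [ c ≔ β ]) ≈ ⋁< (suc p) (λ i → [ window q k i ⇒ summand c β k i ])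
  θ-split-sub k c β k≤1+n =
    sub-≈ c β (θ-split k k≤1+n) ⟨≈⟩
    ≡⇒≈ (⋁<-sub (suc p) guarded c β) ⟨≈⟩ ⋁<-cong (suc p) (λ i _ → ≡⇒≈ ([⇒]-sub (window q k i) _ c β))
    where
    guarded : ℕ → Fm
    guarded i = [ window q k i ⇒ θ xs i ∧ θ ys (k ∸ i) ]

θ-fresh : ∀ as → 1 ≤ length as → ∀ {c} β k → Fresh c as → θ as k [ c ≔ β ] ≡ θ as k
θ-fresh cs 1≤n {c} = halving-induction P base step cs 1≤n
  where
  P : List Lit → Set
  P as = ∀ β k → Fresh c as → θ as k [ c ≔ β ] ≡ θ as k
  base : ∀ a → P (a ∷ [])
  base a β zero _ = refl
  base a β 1 (c≢a ∷ []) = sub-miss β (λ c≡a → c≢a (cong var c≡a))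
  base a β (suc (suc k)) _ = refl
  step : ∀ a b r → P (leftHalf (a ∷ b ∷ r)) → P (rightHalf (a ∷ b ∷ r)) → P (a ∷ b ∷ r)
  step a b r IHl IHr β zero _ = refl
  step a b r IHl IHr β (suc k) fresh with suc k ≤? length (a ∷ b ∷ r)
  ... | no k≰n rewrite θ-beyond (a ∷ b ∷ r) (suc k) (≰⇒> k≰n) = refl
  ... | yes k≤n rewrite Halves.θ-unfold a b r (suc k) (s≤s z≤n) k≤n =
    trans (⋁-sub (map term is) c β)
          (cong ⋁ (trans (sym (map-∘ is))
                         (map-cong (λ i → cong₂ _∧_ (IHl β i (take⁺ p fresh)) (IHr β (suc k ∸ i) (drop⁺ p fresh))) is)))
    where
    open Halves a b r
    term : ℕ → Fm
    term i = θ xs i ∧ θ ys (suc k ∸ i)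
    is : List ℕ
    is = idx (suc p) q (suc k)

θ-all : ∀ as → 1 ≤ length as → θ as (length as) ≈ ⋀ (map at as)
θ-all = halving-induction (λ as → θ as (length as) ≈ ⋀ (map at as)) (λ a → ≈-refl) step
  where
  step : ∀ a b r → θ (leftHalf (a ∷ b ∷ r)) (length (leftHalf (a ∷ b ∷ r))) ≈ ⋀ (map at (leftHalf (a ∷ b ∷ r))) →
                   θ (rightHalf (a ∷ b ∷ r)) (length (rightHalf (a ∷ b ∷ r))) ≈ ⋀ (map at (rightHalf (a ∷ b ∷ r))) →
                   θ (a ∷ b ∷ r) (length (a ∷ b ∷ r)) ≈ ⋀ (map at (a ∷ b ∷ r))
  step a b r IHl IHr =
    Halves.θ-split a b r n (n≤1+n n) ⟨≈⟩
    ⋁<-single (suc p) p ≤-refl others ⟨≈⟩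
    ≡⇒≈ (cong [_⇒ θ xs p ∧ θ ys q ] (window-true (⌊n/2⌋≤n n) ≤-refl)) ⟨≈⟩
    ∧-cong (≡⇒≈ (cong (θ xs) (sym length-xs)) ⟨≈⟩ IHl) (≡⇒≈ (cong (θ ys) (sym length-ys)) ⟨≈⟩ IHr) ⟨≈⟩
    ≈-sym (⋀-++ (map at xs) (map at ys)) ⟨≈⟩
    ≡⇒≈ (cong ⋀ (trans (sym (map-++ at xs ys)) (cong (map at) (take++drop≡id p as))))
    where
    open Halves a b r
    -- for i < p too many atoms are left for the right half
    others : ∀ i → i < suc p → i ≢ p → [ window q n i ⇒ θ xs i ∧ θ ys (n ∸ i) ] ≈ 𝕗
    others i i<1+p i≢p = closed-window q n i _ (begin-strict
        q + i <⟨ +-monoʳ-< q (≤∧≢⇒< (≤-pred i<1+p) i≢p) ⟩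
        q + p ≡⟨ +-comm q p ⟩
        p + q ≡⟨ p+q≡n as ⟩
        n     ∎)
      where open ≤-Reasoning

θ-falseFree : ∀ as → 1 ≤ length as → ∀ k → k ≤ length as → FalseFree (θ as k)
θ-falseFree = halving-induction P base step
  where
  P : List Lit → Set
  P as = ∀ k → k ≤ length as → FalseFree (θ as k)
  base : ∀ a → P (a ∷ [])
  base a zero _ = ff-𝕥
  base a 1 _ = ff-at a
  base a (suc (suc k)) (s≤s ())
  step : ∀ a b r → P (leftHalf (a ∷ b ∷ r)) → P (rightHalf (a ∷ b ∷ r)) → P (a ∷ b ∷ r)
  step a b r IHl IHr zero _ = ff-𝕥
  step a b r IHl IHr (suc k) k≤n rewrite Halves.θ-unfold a b r (suc k) (s≤s z≤n) k≤n =
    ⋁-closed FalseFree ff-∨ _ (map-nonempty _ _ (idx-nonempty-θ (suc k) k≤n))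
      (map⁺ (All.map (λ { {i} (s≤s i≤p , _ , k-i≤q) →
        ff-∧ (IHl i (subst (i ≤_) (sym length-xs) i≤p)) (IHr (suc k ∸ i) (subst (suc k ∸ i ≤_) (sym length-ys) k-i≤q)) })
        (idx-bounds (suc p) q (suc k))))
    where open Halves a b r

θ-weakenable : ∀ as → 1 ≤ length as → ∀ k → 1 ≤ k → k ≤ length as → Weakenable (θ as k)
θ-weakenable = halving-induction P base step
  where
  P : List Lit → Set
  P as = ∀ k → 1 ≤ k → k ≤ length as → Weakenable (θ as k)
  base : ∀ a → P (a ∷ [])
  base a 1 _ _ = w-at a
  base a (suc (suc k)) _ (s≤s ())
  step : ∀ a b r → P (leftHalf (a ∷ b ∷ r)) → P (rightHalf (a ∷ b ∷ r)) → P (a ∷ b ∷ r)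
  step a b r IHl IHr (suc k) _ k≤n rewrite Halves.θ-unfold a b r (suc k) (s≤s z≤n) k≤n =
    ⋁-closed Weakenable w-∨ _ (map-nonempty _ _ (idx-nonempty-θ (suc k) k≤n))
      (map⁺ (All.map (λ { {i} (s≤s i≤p , _ , k-i≤q) → summand-weakenable i i≤p k-i≤q }) (idx-bounds (suc p) q (suc k))))
    where
    open Halves a b r
    left : ∀ i → 1 ≤ i → i ≤ p → Weakenable (θ xs i)
    left i 1≤i i≤p = IHl i 1≤i (subst (i ≤_) (sym length-xs) i≤p)
    right : ∀ j → 1 ≤ j → j ≤ q → Weakenable (θ ys j)
    right j 1≤j j≤q = IHr j 1≤j (subst (j ≤_) (sym length-ys) j≤q)
    -- the summand θ_i ∧ θ_j is weakenable unless i = j = 0, and i + j = k + 1 > 0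
    summand-weakenable : ∀ i → i ≤ p → suc k ∸ i ≤ q → Weakenable (θ xs i ∧ θ ys (suc k ∸ i))
    summand-weakenable zero _ j≤q = w-𝕥∧ (right (suc k) (s≤s z≤n) j≤q)
    summand-weakenable (suc i) i≤p j≤q with k ∸ i
    ... | zero = w-∧𝕥 (left (suc i) (s≤s z≤n) i≤p)
    ... | suc j = w-∧ (left (suc i) (s≤s z≤n) i≤p) (right (suc j) (s≤s z≤n) j≤q)

-- Correctness of Γ.

module ΓSplit (a b : Lit) (r : List Lit) where

  open Halves a b r public

  R-left : ℕ → ℕ → Fm
  R-left k l = ⋀ (map at (removeNth l xs) ++ (θ ys (k ∸ p) ∷ []))

  R-right : ℕ → ℕ → Fm
  R-right k l = ⋀ (θ xs (k ∸ q) ∷ map at (removeNth (l ∸ p) ys))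

  R-left-falseFree : ∀ k l → k ≤ n → FalseFree (R-left k l)
  R-left-falseFree k l k≤n = ⋀-falseFree _ (++⁺ (atoms-falseFree (removeNth l xs))
    (θ-falseFree ys (rightHalf-nonempty a b r) (k ∸ p) (subst (k ∸ p ≤_) (sym length-ys) (k-p≤q k≤n)) ∷ []))

  R-right-falseFree : ∀ k l → k ≤ n → FalseFree (R-right k l)
  R-right-falseFree k l k≤n = ⋀-falseFree _
    (θ-falseFree xs (leftHalf-nonempty a b r) (k ∸ q) (subst (k ∸ q ≤_) (sym length-xs) (k-q≤p k≤n))
     ∷ atoms-falseFree (removeNth (l ∸ p) ys))

  Υ-left : ∀ {k l} → l ≤ p → k ≤ n →
    Υ as k l ≡ (if p ≤ᵇ k then collapse ((θ xs p [ nth as l ≔ 𝕗 ]) ∧ θ ys (k ∸ p)) (R-left k l) else triv 𝕗)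
  Υ-left {k} l≤p k≤n rewrite ≤ᵇ-true l≤p | ≤ᵇ-true k≤n | <ᵇ-false l≤p | ∧-identityʳ (p ≤ᵇ k) = refl

  Υ-right : ∀ {k l} → p < l → k ≤ n →
    Υ as k l ≡ (if q ≤ᵇ k then collapse (θ xs (k ∸ q) ∧ (θ ys q [ nth as l ≔ 𝕗 ])) (R-right k l) else triv 𝕗)
  Υ-right {k} p<l k≤n rewrite ≤ᵇ-false p<l | <ᵇ-true p<l | ≤ᵇ-true k≤n | ∧-identityʳ (q ≤ᵇ k) = refl

  Δ-left : ∀ {k l} → l ≤ p → Δ as (suc k) l ≡ (if suc k ≤ᵇ q then wk (θ ys (suc k)) else triv 𝕗)
  Δ-left {k} l≤p rewrite ≤ᵇ-true l≤p | <ᵇ-false l≤p | ∧-identityʳ (suc k ≤ᵇ q) | ∧-zeroʳ (suc k ≤ᵇ p) = refl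

  Δ-right : ∀ {k l} → p < l → Δ as (suc k) l ≡ (if suc k ≤ᵇ p then wk (θ xs (suc k)) else triv 𝕗)
  Δ-right {k} p<l rewrite ≤ᵇ-false p<l | <ᵇ-true p<l | ∧-identityʳ (suc k ≤ᵇ p) | ∧-zeroʳ (suc k ≤ᵇ q) = refl

  left-body right-body : ℕ → ℕ → ℕ → Deriv
  left-body f k l = ⋁ᴰ (map (λ i → Γf f xs i l ∧ᴰ triv (θ ys (k ∸ i))) (idx p q k)
                        ++ (Υ as k l ∷ Δ as (suc k) l ∷ []))
  right-body f k l = ⋁ᴰ (map (λ i → triv (θ xs i) ∧ᴰ Γf f ys (k ∸ i) (l ∸ p)) (idx (suc p) (q ∸ 1) k)
                         ++ (Υ as k l ∷ Δ as (suc k) l ∷ []))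

  Γ-beyond : ∀ f {k} l → n < k → Γf (suc f) as k l ≡ triv 𝕗
  Γ-beyond f l n<k rewrite <ᵇ-true n<k = refl

  Γ-left : ∀ f {k l} → k ≤ n → l ≤ p → Γf (suc f) as k l ≡ left-body f k l
  Γ-left f k≤n l≤p rewrite <ᵇ-false k≤n | ≤ᵇ-true l≤p = refl

  Γ-right : ∀ f {k l} → k ≤ n → p < l → Γf (suc f) as k l ≡ right-body f k l
  Γ-right f k≤n p<l rewrite <ᵇ-false k≤n | ≤ᵇ-false p<l = refl

  module Left (l : ℕ) (distinct : Distinct as) (1≤l : 1 ≤ l) (l≤p : l ≤ p) where

    c : Lit
    c = nth as l

    c-in-xs : nth xs l ≡ c
    c-in-xs = nth-take as p l 1≤l l≤p

    l≤|xs| : l ≤ length xs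
    l≤|xs| = subst (l ≤_) (sym length-xs) l≤p

    ys-untouched : ∀ β j → θ ys j [ c ≔ β ] ≡ θ ys j
    ys-untouched β j = θ-fresh ys (rightHalf-nonempty a b r) β j
      (fresh-right xs ys (distinct-halves as distinct) (subst (_∈ xs) c-in-xs (nth∈ xs l 1≤l l≤|xs|)))

    Υ-premiss : ∀ k → ((θ xs p [ c ≔ 𝕗 ]) ∧ θ ys (k ∸ p)) ≈ (R-left k l ∧ 𝕗)
    Υ-premiss k =
      ∧-cong (≡⇒≈ (cong₂ (λ m c → θ xs m [ c ≔ 𝕗 ]) (sym length-xs) (sym c-in-xs)) ⟨≈⟩
              sub-≈ (nth xs l) 𝕗 (θ-all xs (leftHalf-nonempty a b r)) ⟨≈⟩
              ⋀-remove xs l (AllPairs.take⁺ p distinct) 1≤l l≤|xs|) ≈-refl ⟨≈⟩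
      ∧-assoc ⟨≈⟩ ∧-cong ≈-refl ∧-comm ⟨≈⟩ ≈-sym ∧-assoc ⟨≈⟩
      ∧-cong (≈-sym (⋀-++ (map at (removeNth l xs)) (θ ys (k ∸ p) ∷ []))) ≈-refl

    Υ-derives : ∀ k → k ≤ n → Derives (Υ as k l) [ window q k p ⇒ summand c 𝕗 k p ] 𝕗
    Υ-derives k k≤n rewrite Υ-left l≤p k≤n | ≤ᵇ-true (k-p≤q k≤n) | ∧-identityʳ (p ≤ᵇ k) with p ≤ᵇ k
    ... | false = trivial-derives 𝕗
    ... | true = exact⇒derives (collapse-exact (Υ-premiss k) (R-left-falseFree k l k≤n))
                   (∧-cong ≈-refl (≡⇒≈ (sym (ys-untouched 𝕗 (k ∸ p))))) ≈-refl

    Δ-derives : ∀ k → Derives (Δ as (suc k) l) 𝕗 [ window q (suc k) 0 ⇒ summand c 𝕥 (suc k) 0 ]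
    Δ-derives k rewrite Δ-left {k} l≤p with suc k ≤ᵇ q in e
    ... | false = trivial-derives 𝕗
    ... | true = exact⇒derives (wk-exact (θ-weakenable ys (rightHalf-nonempty a b r) (suc k) (s≤s z≤n)
                                  (subst (suc k ≤_) (sym length-ys) (≤ᵇ-sound e))))
                   ≈-refl (≈-sym 𝕥∧-unit ⟨≈⟩ ∧-cong ≈-refl (≡⇒≈ (sym (ys-untouched 𝕥 (suc k)))))

    branch-derives : ∀ f k → (∀ i → Derives (Γf f xs i l) (θ xs i [ nth xs l ≔ 𝕗 ]) (θ xs (suc i) [ nth xs l ≔ 𝕥 ])) →
      ∀ i → Derives (Γf f xs i l ∧ᴰ triv (θ ys (k ∸ i))) (summand c 𝕗 k i) (summand c 𝕥 (suc k) (suc i))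
    branch-derives f k IH i rewrite c-in-xs =
      parallel-derives ∧-connective (IH i) (derives tt (≡⇒≈ (sym (ys-untouched 𝕗 (k ∸ i)))) (≡⇒≈ (sym (ys-untouched 𝕥 (k ∸ i)))))

    Γ-derives : ∀ f k → k ≤ n →
      (∀ i → Derives (Γf f xs i l) (θ xs i [ nth xs l ≔ 𝕗 ]) (θ xs (suc i) [ nth xs l ≔ 𝕥 ])) →
      Derives (left-body f k l) (θ as k [ c ≔ 𝕗 ]) (θ as (suc k) [ c ≔ 𝕥 ])
    -- Premiss: the summands i < p from the branches and i = p from Υ give θ^n_k{a_l/𝕗}.
    -- Conclusion: the summands i + 1 ≤ p from the branches and i = 0 from Δ give θ^n_{k+1}{a_l/𝕥}.
    Γ-derives f k k≤n IH =
      derives-≈ (⋁ᴰ-derives _ (idx p q k) (branch-derives f k IH) (Υ-derives k k≤n) (Δ-derives k))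
        (∨-cong (⋁-idx (summand c 𝕗 k) p q k) ∨-unit ⟨≈⟩
         ≈-sym (⋁<-suc p _) ⟨≈⟩
         ≈-sym (θ-split-sub k c 𝕗 (m≤n⇒m≤1+n k≤n)))
        (∨-cong (⋁-idx (λ i → summand c 𝕥 (suc k) (suc i)) p q k ⟨≈⟩
                 ⋁<-cong p (λ i _ → ≡⇒≈ (cong [_⇒ summand c 𝕥 (suc k) (suc i) ] (sym (window-suc q k i)))))
                𝕗∨-unit ⟨≈⟩
         ∨-comm ⟨≈⟩ ≈-sym (⋁<-shift p _) ⟨≈⟩
         ≈-sym (θ-split-sub (suc k) c 𝕥 (s≤s k≤n)))

  module Right (l : ℕ) (distinct : Distinct as) (p<l : p < l) (l≤n : l ≤ n) where

    c : Lit
    c = nth as l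

    l' : ℕ
    l' = l ∸ p

    c-in-ys : nth ys l' ≡ c
    c-in-ys = nth-drop as p l p<l

    1≤l' : 1 ≤ l'
    1≤l' = m<n⇒0<n∸m p<l

    l'≤|ys| : l' ≤ length ys
    l'≤|ys| = subst (l' ≤_) (sym length-ys) (∸-monoˡ-≤ p l≤n)

    xs-untouched : ∀ β i → θ xs i [ c ≔ β ] ≡ θ xs i
    xs-untouched β i = θ-fresh xs (leftHalf-nonempty a b r) β i
      (fresh-left xs ys (distinct-halves as distinct) (subst (_∈ ys) c-in-ys (nth∈ ys l' 1≤l' l'≤|ys|)))

    Υ-premiss : ∀ k → (θ xs (k ∸ q) ∧ (θ ys q [ c ≔ 𝕗 ])) ≈ (R-right k l ∧ 𝕗)
    Υ-premiss k =
      ∧-cong ≈-refl (≡⇒≈ (cong₂ (λ m c → θ ys m [ c ≔ 𝕗 ]) (sym length-ys) (sym c-in-ys)) ⟨≈⟩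
                     sub-≈ (nth ys l') 𝕗 (θ-all ys (rightHalf-nonempty a b r)) ⟨≈⟩
                     ⋀-remove ys l' (AllPairs.drop⁺ p distinct) 1≤l' l'≤|ys|) ⟨≈⟩
      ≈-sym ∧-assoc ⟨≈⟩ ∧-cong (≈-sym (⋀-cons (θ xs (k ∸ q)) (map at (removeNth l' ys)))) ≈-refl

    Υ-derives : ∀ k → k ≤ n → Derives (Υ as k l) [ q ≤ᵇ k ⇒ summand c 𝕗 k (k ∸ q) ] 𝕗
    Υ-derives k k≤n rewrite Υ-right p<l k≤n with q ≤ᵇ k in e
    ... | false = trivial-derives 𝕗
    ... | true = exact⇒derives (collapse-exact (Υ-premiss k) (R-right-falseFree k l k≤n))
                   (∧-cong (≡⇒≈ (sym (xs-untouched 𝕗 (k ∸ q))))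
                           (≡⇒≈ (cong (λ j → θ ys j [ c ≔ 𝕗 ]) (sym (m∸[m∸n]≡n (≤ᵇ-sound {q} {k} e))))))
                   ≈-refl

    Δ-derives : ∀ k → Derives (Δ as (suc k) l) 𝕗 [ suc k ≤ᵇ p ⇒ summand c 𝕥 (suc k) (suc k) ]
    Δ-derives k rewrite Δ-right {k} p<l with suc k ≤ᵇ p in e
    ... | false = trivial-derives 𝕗
    ... | true = exact⇒derives (wk-exact (θ-weakenable xs (leftHalf-nonempty a b r) (suc k) (s≤s z≤n)
                                  (subst (suc k ≤_) (sym length-xs) (≤ᵇ-sound e))))
                   ≈-refl
                   (≈-sym ∧-unit ⟨≈⟩ ∧-cong (≡⇒≈ (sym (xs-untouched 𝕥 (suc k))))
                                            (≡⇒≈ (cong (λ j → θ ys j [ c ≔ 𝕥 ]) (sym (n∸n≡0 k)))))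

    branch-derives : ∀ f k → (∀ j → Derives (Γf f ys j l') (θ ys j [ nth ys l' ≔ 𝕗 ]) (θ ys (suc j) [ nth ys l' ≔ 𝕥 ])) →
      ∀ i → Derives (triv (θ xs i) ∧ᴰ Γf f ys (k ∸ i) l') (summand c 𝕗 k i) ((θ xs i [ c ≔ 𝕥 ]) ∧ (θ ys (suc (k ∸ i)) [ c ≔ 𝕥 ]))
    branch-derives f k IH i rewrite c-in-ys =
      parallel-derives ∧-connective (derives tt (≡⇒≈ (sym (xs-untouched 𝕗 i))) (≡⇒≈ (sym (xs-untouched 𝕥 i)))) (IH (k ∸ i))

    Γ-derives : ∀ f k → k ≤ n →
      (∀ j → Derives (Γf f ys j l') (θ ys j [ nth ys l' ≔ 𝕗 ]) (θ ys (suc j) [ nth ys l' ≔ 𝕥 ])) →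
      Derives (right-body f k l) (θ as k [ c ≔ 𝕗 ]) (θ as (suc k) [ c ≔ 𝕥 ])
    -- Premiss: the summands with j < q from the branches and j = q from Υ give θ^n_k{a_l/𝕗}.
    -- Conclusion: the summands i ≤ k from the branches and i = k + 1 from Δ give θ^n_{k+1}{a_l/𝕥}.
    Γ-derives f k k≤n IH =
      derives-≈ (⋁ᴰ-derives _ (idx (suc p) (q ∸ 1) k) (branch-derives f k IH) (Υ-derives k k≤n) (Δ-derives k))
        (∨-cong (⋁-idx (summand c 𝕗 k) (suc p) (q ∸ 1) k)
                (∨-unit ⟨≈⟩ ≡⇒≈ (cong [_⇒ [ q ≤ᵇ k ⇒ summand c 𝕗 k (k ∸ q) ] ] (sym (<ᵇ-true (s≤s (k-q≤p k≤n)))))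
                        ⟨≈⟩ ≈-sym (⋁<-at (suc p) (k ∸ q) (λ i → [ q ≤ᵇ k ⇒ summand c 𝕗 k i ]))) ⟨≈⟩
         ≈-sym (⋁<-split (suc p) (λ i _ → window-lower q k i (summand c 𝕗 k i) (1≤q a b r))) ⟨≈⟩
         ≈-sym (θ-split-sub k c 𝕗 (m≤n⇒m≤1+n k≤n)))
        (∨-cong (⋁-idx _ (suc p) (q ∸ 1) k ⟨≈⟩ ⋁<-cong (suc p) (λ i _ → [⇒]-cong-when (window (q ∸ 1) k i) (raise i)))
                (𝕗∨-unit ⟨≈⟩ ≈-sym (⋁<-at (suc p) (suc k) (summand c 𝕥 (suc k)))) ⟨≈⟩
         ≈-sym (⋁<-split (suc p) (λ i _ → window-raise q k i (summand c 𝕥 (suc k) i) (1≤q a b r))) ⟨≈⟩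
         ≈-sym (θ-split-sub (suc k) c 𝕥 (s≤s k≤n)))
      where
      -- in the window i ≤ k, so (k - i) + 1 = (k + 1) - i
      raise : ∀ i → T (window (q ∸ 1) k i) →
              ((θ xs i [ c ≔ 𝕥 ]) ∧ (θ ys (suc (k ∸ i)) [ c ≔ 𝕥 ])) ≈ summand c 𝕥 (suc k) i
      raise i w = ≡⇒≈ (cong (λ j → (θ xs i [ c ≔ 𝕥 ]) ∧ (θ ys j [ c ≔ 𝕥 ])) (sym (+-∸-assoc 1 (proj₁ (window-sound {q ∸ 1} {k} {i} w)))))

Γ-correct : ∀ as → 1 ≤ length as → ∀ f → length as ≤ f → Distinct as → ∀ k l → 1 ≤ l → l ≤ length as →
            Derives (Γf f as k l) (θ as k [ nth as l ≔ 𝕗 ]) (θ as (suc k) [ nth as l ≔ 𝕥 ])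
Γ-correct = halving-induction P base step
  where
  P : List Lit → Set
  P as = ∀ f → length as ≤ f → Distinct as → ∀ k l → 1 ≤ l → l ≤ length as →
         Derives (Γf f as k l) (θ as k [ nth as l ≔ 𝕗 ]) (θ as (suc k) [ nth as l ≔ 𝕥 ])
  base : ∀ a → P (a ∷ [])
  base a f _ _ zero 1 _ _ = derives tt ≈-refl (≡⇒≈ (sym (sub-hit a 𝕥)))
  base a f _ _ 1 1 _ _ = derives tt (≡⇒≈ (sym (sub-hit a 𝕗))) ≈-refl
  base a f _ _ (suc (suc k)) 1 _ _ = trivial-derives 𝕗
  base a f _ _ k (suc (suc l)) _ (s≤s ())
  step : ∀ a b r → P (leftHalf (a ∷ b ∷ r)) → P (rightHalf (a ∷ b ∷ r)) → P (a ∷ b ∷ r)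
  step a b r IHl IHr (suc f) n≤1+f distinct k l 1≤l l≤n with k ≤? length (a ∷ b ∷ r)
  ... | no k≰n rewrite ΓSplit.Γ-beyond a b r f l (≰⇒> k≰n) | θ-beyond (a ∷ b ∷ r) k (≰⇒> k≰n)
                     | θ-beyond (a ∷ b ∷ r) (suc k) (m<n⇒m<1+n (≰⇒> k≰n)) = trivial-derives 𝕗
  ... | yes k≤n with l ≤? pOf (a ∷ b ∷ r)
  ...   | yes l≤p rewrite ΓSplit.Γ-left a b r f k≤n l≤p =
    Left.Γ-derives l distinct 1≤l l≤p f k k≤n
      (λ i → IHl f (fuel (leftHalf-shorter a b r)) (AllPairs.take⁺ p distinct) i l 1≤l (subst (l ≤_) (sym length-xs) l≤p))
    where
    open ΓSplit a b r
    fuel : ∀ {m} → m < n → m ≤ f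
    fuel m<n = ≤-pred (≤-trans m<n n≤1+f)
  ...   | no l≰p rewrite ΓSplit.Γ-right a b r f k≤n (≰⇒> l≰p) =
    Right.Γ-derives l distinct (≰⇒> l≰p) l≤n f k k≤n
      (λ j → IHr f (fuel (rightHalf-shorter a b r)) (AllPairs.drop⁺ p distinct) j (l ∸ p)
                 (Right.1≤l' l distinct (≰⇒> l≰p) l≤n) (Right.l'≤|ys| l distinct (≰⇒> l≰p) l≤n))
    where
    open ΓSplit a b r
    fuel : ∀ {m} → m < n → m ≤ f
    fuel m<n = ≤-pred (≤-trans m<n n≤1+f)

-- The size of Γ.

bound : ℕ → ℕ → ℕ
bound n d = n ^ (7 * d)

bound≥1 : ∀ {n} d → 1 ≤ n → 1 ≤ bound n d
bound≥1 {n} d 1≤n = subst (_≤ bound n d) (^-zeroˡ (7 * d)) (^-monoˡ-≤ (7 * d) 1≤n)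

bound-suc : ∀ n d → bound n (suc d) ≡ n ^ 7 * bound n d
bound-suc n d = trans (cong (n ^_) (*-suc 7 d)) (^-distribˡ-+-* n 7 (7 * d))

module Level (n N : ℕ) (2≤n : 2 ≤ n) (1≤N : 1 ≤ N) where

  -- The cost of every block of Γ (a branch, Υ or Δ).
  block : ℕ
  block = 8 * (n * N)

  1≤nN : 1 ≤ n * N
  1≤nN = *-mono-≤ (≤-trans (s≤s z≤n) 2≤n) 1≤N

  2N≤nN : 2 * N ≤ n * N
  2N≤nN = *-monoˡ-≤ N 2≤n

  n≤nN : n ≤ n * N
  n≤nN = subst (_≤ n * N) (*-identityʳ n) (*-monoʳ-≤ n 1≤N)

  ≤n* : ∀ m → m ≤ n * m
  ≤n* m = subst (_≤ n * m) (*-identityˡ m) (*-monoˡ-≤ m (≤-trans (s≤s z≤n) 2≤n))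

  N+N≤block : N + N ≤ block
  N+N≤block = begin
    N + N         ≡⟨ cong (N +_) (sym (+-identityʳ N)) ⟩
    2 * N         ≤⟨ 2N≤nN ⟩
    n * N         ≤⟨ m≤n*m (n * N) 8 ⟩
    8 * (n * N)   ∎
    where open ≤-Reasoning

  -- a collapse Υ of X with |X| ≤ 2N and R with |R| ≤ 1 + n + N fits into a block
  collapse≤block : (N + N) + 2 * (1 + (n + N)) + 1 ≤ block
  collapse≤block = begin
    (N + N) + 2 * (1 + (n + N)) + 1     ≡⟨ solve-rearrange n N ⟩
    2 * (2 * N) + 2 * n + 3 * 1         ≤⟨ +-mono-≤ (+-mono-≤ (*-monoʳ-≤ 2 2N≤nN) (*-monoʳ-≤ 2 n≤nN)) (*-monoʳ-≤ 3 1≤nN) ⟩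
    2 * (n * N) + 2 * (n * N) + 3 * (n * N) ≤⟨ m≤m+n _ (n * N) ⟩
    2 * (n * N) + 2 * (n * N) + 3 * (n * N) + n * N ≡⟨ solve-eight (n * N) ⟩
    8 * (n * N)                         ∎
    where
    open ≤-Reasoning
    solve-rearrange : ∀ n N → (N + N) + 2 * (1 + (n + N)) + 1 ≡ 2 * (2 * N) + 2 * n + 3 * 1
    solve-rearrange = solve-∀
    solve-eight : ∀ x → 2 * x + 2 * x + 3 * x + x ≡ 8 * x
    solve-eight = solve-∀

  -- n + 2 blocks, and the unit of the empty disjunction, fit into n⁷·N.
  blocks≤ : 1 + (n + 2) * block ≤ n ^ 7 * N
  blocks≤ = begin
    1 + (n + 2) * block                 ≤⟨ +-mono-≤ (≤-trans 1≤nN (≤n* (n * N))) (*-monoˡ-≤ block (+-monoʳ-≤ n 2≤n)) ⟩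
    n * (n * N) + (n + n) * block       ≡⟨ solve-seventeen n (n * N) ⟩
    17 * (n * (n * N))                  ≤⟨ *-monoˡ-≤ (n * (n * N)) 17≤2^5 ⟩
    2 ^ 5 * (n * (n * N))               ≤⟨ *-monoˡ-≤ (n * (n * N)) (^-monoˡ-≤ 5 2≤n) ⟩
    n ^ 5 * (n * (n * N))               ≡⟨ powers ⟩
    n ^ 7 * N                           ∎
    where
    open ≤-Reasoning
    17≤2^5 : 17 ≤ 2 ^ 5
    17≤2^5 = ≤ᵇ⇒≤ 17 32 tt
    solve-seventeen : ∀ n x → n * x + (n + n) * (8 * x) ≡ 17 * (n * x)
    solve-seventeen = solve-∀
    powers : n ^ 5 * (n * (n * N)) ≡ n ^ 7 * N
    powers = begin-equality
      n ^ 5 * (n * (n * N))   ≡⟨ cong (n ^ 5 *_) (sym (*-assoc n n N)) ⟩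
      n ^ 5 * (n * n * N)     ≡⟨ sym (*-assoc (n ^ 5) (n * n) N) ⟩
      n ^ 5 * (n * n) * N     ≡⟨ cong (λ m → n ^ 5 * (n * m) * N) (sym (*-identityʳ n)) ⟩
      n ^ 5 * n ^ 2 * N       ≡⟨ cong (_* N) (sym (^-distribˡ-+-* n 5 2)) ⟩
      n ^ 7 * N               ∎

  -- At most n summands of size ≤ N + N, for θ.
  summands≤ : 1 + n * (N + N) ≤ n ^ 7 * N
  summands≤ = ≤-trans (+-monoʳ-≤ 1 (*-mono-≤ (m≤m+n n 2) N+N≤block)) blocks≤

fsize-⋁ : ∀ {B} φs → All (λ φ → fsize φ ≤ B) φs → fsize (⋁ φs) ≤ 1 + length φs * B
fsize-⋁ [] [] = ≤-refl
fsize-⋁ {B} (φ ∷ []) (h ∷ []) = ≤-trans h (≤-trans (m≤n+m B 1) (+-monoʳ-≤ 1 (≤-reflexive (sym (+-identityʳ B)))))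
fsize-⋁ {B} (φ ∷ ψ ∷ φs) (h ∷ hs) = ≤-trans (+-mono-≤ h (fsize-⋁ (ψ ∷ φs) hs)) (≤-reflexive (+-suc B _))

halves-fit : ∀ as d → length as ≤ 2 ^ suc d → length (leftHalf as) ≤ 2 ^ d × length (rightHalf as) ≤ 2 ^ d
halves-fit as d n≤2M = subst (_≤ M) (sym (length-leftHalf as)) (≤-trans (⌊n/2⌋≤⌈n/2⌉ (length as)) ⌈n/2⌉≤M)
                     , subst (_≤ M) (sym (trans (length-rightHalf as) (q≡⌈n/2⌉ as))) ⌈n/2⌉≤M
  where
  M : ℕ
  M = 2 ^ d
  ⌈n/2⌉≤M : ⌈ length as /2⌉ ≤ M
  ⌈n/2⌉≤M = subst (⌈ length as /2⌉ ≤_) (sym (n≡⌈n+n/2⌉ M))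
              (⌈n/2⌉-mono (subst (length as ≤_) (cong (M +_) (+-identityʳ M)) n≤2M))

θ-singleton-size : ∀ a k → fsize (θ (a ∷ []) k) ≡ 1
θ-singleton-size a zero = refl
θ-singleton-size a 1 = refl
θ-singleton-size a (suc (suc k)) = refl

θ-size : ∀ n as → 1 ≤ length as → length as ≤ n → ∀ d → length as ≤ 2 ^ d → ∀ k → fsize (θ as k) ≤ bound n d
θ-size n cs 1≤m m≤n = halving-induction P base step cs 1≤m m≤n
  where
  P : List Lit → Set
  P cs = length cs ≤ n → ∀ d → length cs ≤ 2 ^ d → ∀ k → fsize (θ cs k) ≤ bound n d
  base : ∀ a → P (a ∷ [])
  base a 1≤n d _ k = subst (_≤ bound n d) (sym (θ-singleton-size a k)) (bound≥1 d 1≤n)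
  step : ∀ a b r → P (leftHalf (a ∷ b ∷ r)) → P (rightHalf (a ∷ b ∷ r)) → P (a ∷ b ∷ r)
  step a b r IHl IHr m≤n zero (s≤s ()) k
  step a b r IHl IHr m≤n (suc d) m≤2^[1+d] k with k ≤? length (a ∷ b ∷ r)
  ... | no k≰m rewrite θ-beyond (a ∷ b ∷ r) k (≰⇒> k≰m) = bound≥1 (suc d) (≤-trans (s≤s z≤n) m≤n)
  ... | yes k≤m = go k k≤m
    where
    open Halves a b r using (as; p; q; xs; ys)
    open Level n (bound n d) (≤-trans (s≤s (s≤s z≤n)) m≤n) (bound≥1 d (≤-trans (s≤s z≤n) m≤n))
    summand-size : ∀ k i → fsize (θ xs i ∧ θ ys (k ∸ i)) ≤ bound n d + bound n d
    summand-size k i = +-mono-≤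
      (IHl (≤-trans (<⇒≤ (leftHalf-shorter a b r)) m≤n) d (proj₁ (halves-fit as d m≤2^[1+d])) i)
      (IHr (≤-trans (<⇒≤ (rightHalf-shorter a b r)) m≤n) d (proj₂ (halves-fit as d m≤2^[1+d])) (k ∸ i))
    go : ∀ k → k ≤ length as → fsize (θ as k) ≤ bound n (suc d)
    go zero _ = bound≥1 (suc d) (≤-trans (s≤s z≤n) m≤n)
    go (suc k) k≤m rewrite Halves.θ-unfold a b r (suc k) (s≤s z≤n) k≤m | bound-suc n d = begin
      fsize (⋁ (map (λ i → θ xs i ∧ θ ys (suc k ∸ i)) is))
        ≤⟨ fsize-⋁ (map (λ i → θ xs i ∧ θ ys (suc k ∸ i)) is) (map⁺ (All.universal (summand-size (suc k)) is)) ⟩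
      1 + length (map (λ i → θ xs i ∧ θ ys (suc k ∸ i)) is) * (bound n d + bound n d)
        ≤⟨ +-monoʳ-≤ 1 (*-monoˡ-≤ (bound n d + bound n d) terms≤n) ⟩
      1 + n * (bound n d + bound n d)
        ≤⟨ summands≤ ⟩
      n ^ 7 * bound n d ∎
      where
      open ≤-Reasoning
      is : List ℕ
      is = idx (suc p) q (suc k)
      terms≤n : length (map (λ i → θ xs i ∧ θ ys (suc k ∸ i)) is) ≤ n
      terms≤n = ≤-trans (≤-reflexive (length-map _ is)) (≤-trans (idx-length (suc p) q (suc k)) (≤-trans (p<n a b r) m≤n))

module BlockCosts (n : ℕ) (a b : Lit) (r : List Lit) (m≤n : length (a ∷ b ∷ r) ≤ n)
                  (d : ℕ) (m≤2^[1+d] : length (a ∷ b ∷ r) ≤ 2 ^ suc d) where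

  open ΓSplit a b r using (as; p; q; xs; ys; R-left; R-right; R-left-falseFree; R-right-falseFree;
                          Υ-left; Υ-right; Δ-left; Δ-right; length-xs; length-ys)

  N : ℕ
  N = bound n d

  1≤n : 1 ≤ n
  1≤n = ≤-trans (s≤s z≤n) m≤n

  open Level n N (≤-trans (s≤s (s≤s z≤n)) m≤n) (bound≥1 d 1≤n) public

  xs≤n : length xs ≤ n
  xs≤n = ≤-trans (<⇒≤ (leftHalf-shorter a b r)) m≤n

  ys≤n : length ys ≤ n
  ys≤n = ≤-trans (<⇒≤ (rightHalf-shorter a b r)) m≤n

  θxs-size : ∀ i → fsize (θ xs i) ≤ N
  θxs-size = θ-size n xs (leftHalf-nonempty a b r) xs≤n d (proj₁ (halves-fit as d m≤2^[1+d]))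

  θys-size : ∀ j → fsize (θ ys j) ≤ N
  θys-size = θ-size n ys (rightHalf-nonempty a b r) ys≤n d (proj₂ (halves-fit as d m≤2^[1+d]))

  trivial≤block : Cost block (triv 𝕗)
  trivial≤block = trivial-cost 𝕗 (≤-trans (bound≥1 d 1≤n) (≤-trans (m≤m+n N N) N+N≤block))

  collapse≤ : ∀ {X R} → FalseFree R → fsize X ≤ N + N → fsize R ≤ 1 + (n + N) → Cost block (collapse X R)
  collapse≤ {X} {R} ffR X≤ R≤ =
    cost-mono (collapse X R) (≤-trans (+-monoˡ-≤ 1 (+-mono-≤ X≤ (*-monoʳ-≤ 2 R≤))) collapse≤block) (collapse-cost X ffR)

  branch-left≤ : ∀ {Φ} j → Cost N Φ → Cost block (Φ ∧ᴰ triv (θ ys j))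
  branch-left≤ {Φ} j (cost w s) = cost-mono (Φ ∧ᴰ triv (θ ys j)) N+N≤block
    (cost (width-parallel ∧-connective Φ (triv (θ ys j)) w (θys-size j ∷ []))
          (≤-trans (≤-reflexive (trans (steps-parallel _∧_ Φ (triv (θ ys j))) (+-identityʳ _))) (≤-trans s (m≤m+n N N))))

  branch-right≤ : ∀ {Φ} i → Cost N Φ → Cost block (triv (θ xs i) ∧ᴰ Φ)
  branch-right≤ {Φ} i (cost w s) = cost-mono (triv (θ xs i) ∧ᴰ Φ) N+N≤block
    (cost (width-parallel ∧-connective (triv (θ xs i)) Φ (θxs-size i ∷ []) w)
          (≤-trans (≤-reflexive (steps-parallel _∧_ (triv (θ xs i)) Φ)) (≤-trans s (m≤m+n N N))))

  Υ-left≤ : ∀ k l → l ≤ p → k ≤ length as → Cost block (Υ as k l)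
  Υ-left≤ k l l≤p k≤m rewrite Υ-left {k} {l} l≤p k≤m with p ≤ᵇ k
  ... | false = trivial≤block
  ... | true = collapse≤ (R-left-falseFree k l k≤m)
    (+-mono-≤ (≤-trans (≤-reflexive (fsize-sub (θ xs p) (nth as l) 𝕗 refl)) (θxs-size p)) (θys-size (k ∸ p)))
    (≤-trans (fsize-atoms∧ (removeNth l xs) (θ ys (k ∸ p)))
             (+-monoʳ-≤ 1 (+-mono-≤ (≤-trans (length-removeNth l xs) xs≤n) (θys-size (k ∸ p)))))

  Υ-right≤ : ∀ k l → p < l → k ≤ length as → Cost block (Υ as k l)
  Υ-right≤ k l p<l k≤m rewrite Υ-right {k} {l} p<l k≤m with q ≤ᵇ k
  ... | false = trivial≤block
  ... | true = collapse≤ (R-right-falseFree k l k≤m)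
    (+-mono-≤ (θxs-size (k ∸ q)) (≤-trans (≤-reflexive (fsize-sub (θ ys q) (nth as l) 𝕗 refl)) (θys-size q)))
    (≤-trans (fsize-∧atoms (θ xs (k ∸ q)) (removeNth (l ∸ p) ys))
             (+-monoʳ-≤ 1 (≤-trans (+-mono-≤ (θxs-size (k ∸ q)) (≤-trans (length-removeNth (l ∸ p) ys) ys≤n))
                                   (≤-reflexive (+-comm N n)))))

  Δ-left≤ : ∀ k l → l ≤ p → Cost block (Δ as (suc k) l)
  Δ-left≤ k l l≤p rewrite Δ-left {k} {l} l≤p with suc k ≤ᵇ q in e
  ... | false = trivial≤block
  ... | true = cost-mono (wk (θ ys (suc k))) N+N≤block
    (wk-cost (θ-weakenable ys (rightHalf-nonempty a b r) (suc k) (s≤s z≤n) (subst (suc k ≤_) (sym length-ys) (≤ᵇ-sound e)))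
             (θys-size (suc k)))

  Δ-right≤ : ∀ k l → p < l → Cost block (Δ as (suc k) l)
  Δ-right≤ k l p<l rewrite Δ-right {k} {l} p<l with suc k ≤ᵇ p in e
  ... | false = trivial≤block
  ... | true = cost-mono (wk (θ xs (suc k))) N+N≤block
    (wk-cost (θ-weakenable xs (leftHalf-nonempty a b r) (suc k) (s≤s z≤n) (subst (suc k ≤_) (sym length-xs) (≤ᵇ-sound e)))
             (θxs-size (suc k)))

  body≤ : ∀ (G : ℕ → Deriv) is Y Z → length is ≤ n → (∀ i → Cost block (G i)) → Cost block Y → Cost block Z →
          Cost (bound n (suc d)) (⋁ᴰ (map G is ++ (Y ∷ Z ∷ [])))
  body≤ G is Y Z is≤n cG cY cZ =
    cost-mono (⋁ᴰ ds) (≤-trans (+-monoʳ-≤ 1 (*-monoˡ-≤ block length≤)) (≤-trans blocks≤ (≤-reflexive (sym (bound-suc n d)))))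
      (⋁ᴰ-cost ds (++⁺ (map⁺ (All.universal cG is)) (cY ∷ cZ ∷ [])))
    where
    ds : List Deriv
    ds = map G is ++ (Y ∷ Z ∷ [])
    length≤ : length ds ≤ n + 2
    length≤ = ≤-trans (≤-reflexive (trans (length-++ (map G is)) (cong (_+ 2) (length-map G is)))) (+-monoˡ-≤ 2 is≤n)

Γ-cost : ∀ n cs → 1 ≤ length cs → length cs ≤ n → ∀ f → length cs ≤ f → ∀ d → length cs ≤ 2 ^ d →
         ∀ k l → Cost (bound n d) (Γf f cs k l)
Γ-cost n cs 1≤m m≤n = halving-induction P base step cs 1≤m m≤n
  where
  P : List Lit → Set
  P cs = length cs ≤ n → ∀ f → length cs ≤ f → ∀ d → length cs ≤ 2 ^ d → ∀ k l → Cost (bound n d) (Γf f cs k l)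
  base : ∀ a → P (a ∷ [])
  base a 1≤n f _ d _ zero l = trivial-cost 𝕥 (bound≥1 d 1≤n)
  base a 1≤n f _ d _ (suc k) l = trivial-cost 𝕗 (bound≥1 d 1≤n)
  step : ∀ a b r → P (leftHalf (a ∷ b ∷ r)) → P (rightHalf (a ∷ b ∷ r)) → P (a ∷ b ∷ r)
  step a b r IHl IHr m≤n (suc f) m≤1+f zero (s≤s ()) k l
  step a b r IHl IHr m≤n (suc f) m≤1+f (suc d) m≤2^[1+d] k l with k ≤? length (a ∷ b ∷ r)
  ... | no k≰m rewrite ΓSplit.Γ-beyond a b r f l (≰⇒> k≰m) = trivial-cost 𝕗 (bound≥1 (suc d) (≤-trans (s≤s z≤n) m≤n))
  ... | yes k≤m with l ≤? pOf (a ∷ b ∷ r)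
  ...   | yes l≤p rewrite ΓSplit.Γ-left a b r f k≤m l≤p =
    body≤ _ (idx p q k) _ _ (≤-trans (idx-length p q k) (≤-trans (<⇒≤ (p<n a b r)) m≤n))
      (λ i → branch-left≤ (k ∸ i) (Γxs i l)) (Υ-left≤ k l l≤p k≤m) (Δ-left≤ k l l≤p)
    where
    open ΓSplit a b r using (p; q; xs)
    open BlockCosts n a b r m≤n d m≤2^[1+d]
    Γxs : ∀ i l → Cost N (Γf f xs i l)
    Γxs = IHl xs≤n f (≤-pred (≤-trans (leftHalf-shorter a b r) m≤1+f)) d (proj₁ (halves-fit (a ∷ b ∷ r) d m≤2^[1+d]))
  ...   | no l≰p rewrite ΓSplit.Γ-right a b r f k≤m (≰⇒> l≰p) =
    body≤ _ (idx (suc p) (q ∸ 1) k) _ _ (≤-trans (idx-length (suc p) (q ∸ 1) k) (≤-trans (p<n a b r) m≤n))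
      (λ i → branch-right≤ i (Γys (k ∸ i) (l ∸ p))) (Υ-right≤ k l (≰⇒> l≰p) k≤m) (Δ-right≤ k l (≰⇒> l≰p))
    where
    open ΓSplit a b r using (p; q; ys)
    open BlockCosts n a b r m≤n d m≤2^[1+d]
    Γys : ∀ j l → Cost N (Γf f ys j l)
    Γys = IHr ys≤n f (≤-pred (≤-trans (rightHalf-shorter a b r) m≤1+f)) d (proj₂ (halves-fit (a ∷ b ∷ r) d m≤2^[1+d]))

size-of-cost : ∀ {X} d → 1 ≤ X → Cost X d → size d ≤ 2 * (X * X)
size-of-cost {X} d 1≤X (cost w s) = begin
  size d             ≤⟨ size≤ d w ⟩
  suc (steps d) * X  ≤⟨ *-monoˡ-≤ X (s≤s s) ⟩
  suc X * X          ≤⟨ *-monoˡ-≤ X (+-monoˡ-≤ X 1≤X) ⟩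
  (X + X) * X        ≡⟨ cong (_* X) (cong (X +_) (sym (+-identityʳ X))) ⟩
  2 * X * X          ≡⟨ *-assoc 2 X X ⟩
  2 * (X * X)        ∎
  where open ≤-Reasoning

n≤2^[1+⌊log₂n⌋] : ∀ n → n ≤ 2 ^ suc ⌊log₂ n ⌋
n≤2^[1+⌊log₂n⌋] n with n ≤? 2 ^ suc ⌊log₂ n ⌋
... | yes n≤2^[1+L] = n≤2^[1+L]
... | no n≰2^[1+L] = ⊥-elim (<-irrefl refl (begin-strict
  ⌊log₂ n ⌋                           <⟨ n<1+n _ ⟩
  suc ⌊log₂ n ⌋                       ≡⟨ ⌊log₂[2^n]⌋≡n (suc ⌊log₂ n ⌋) ⟨
  ⌊log₂ (2 ^ suc ⌊log₂ n ⌋) ⌋         ≤⟨ ⌊log₂⌋-mono-≤ (<⇒≤ (≰⇒> n≰2^[1+L])) ⟩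
  ⌊log₂ n ⌋                           ∎))
  where open ≤-Reasoning

square-bound : ∀ n D → 2 * (bound n D * bound n D) ≤ 14 * n ^ (14 * D)
square-bound n D = *-mono-≤ (≤ᵇ⇒≤ 2 14 tt) (≤-reflexive (begin-equality
  n ^ (7 * D) * n ^ (7 * D)   ≡⟨ ^-distribˡ-+-* n (7 * D) (7 * D) ⟨
  n ^ (7 * D + 7 * D)         ≡⟨ cong (n ^_) (*-distribʳ-+ D 7 7) ⟨
  n ^ (14 * D)                ∎))
  where open ≤-Reasoning

theorem5p9 : ∃[ c ] ((as : List Lit) → 0 < length as → Unique (map var as) →
               (k l : ℕ) → 1 ≤ l → l ≤ length as →
               Valid (Γ as k l)
               × prem (Γ as k l) ≈ (θ as k [ nth as l ≔ 𝕗 ])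
               × concl (Γ as k l) ≈ (θ as (suc k) [ nth as l ≔ 𝕥 ])
               × size (Γ as k l) ≤ c * length as ^ (c * suc ⌊log₂ length as ⌋))
theorem5p9 = 14 , λ as 0<n unique k l 1≤l l≤n →
  let n = length as
      D = suc ⌊log₂ n ⌋
      correct = Γ-correct as 0<n n ≤-refl (AllPairs.map⁻ unique) k l 1≤l l≤n
      costed = Γ-cost n as 0<n ≤-refl n ≤-refl D (n≤2^[1+⌊log₂n⌋] n) k l
  in valid≈ correct , premiss≈ correct , conclusion≈ correct ,
     ≤-trans (size-of-cost (Γ as k l) (bound≥1 D 0<n) costed) (square-bound n D)
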